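{- Let $D:\mathbb{Q}\to\{0,1\}$ be the Dedekind cut of an irrational $\alpha\in(0,1)$. There is a function-oracle Turing machine $M$ such that, with oracle $D$, $M$ computes the Hurwitz characteristic of $\alpha$, and on input $n$ it runs in time bounded by a polynomial in $n$ and makes exactly $n$ oracle calls, each of input size $O(n)$.
   Context: The Dedekind cut of $\alpha$ is $D(q)=0$ iff $q<\alpha$ (and $D(q)=1$ iff $q>\alpha$). The Farey pair tree $\mathcal{F}$ assigns to each $\sigma\in\{0,1\}^*$ a pair of fractions, identified with the open interval between them: $\mathcal{F}(\epsilon)=(0/1,1/1)$, and if $\mathcal{F}(\sigma)=(a/b,c/d)$ then $\mathcal{F}(\sigma0)=(a/b,(a+c)/(b+d))$ and $\mathcal{F}(\sigma1)=((a+c)/(b+d),c/d)$. The Hurwitz characteristic of $\alpha$ is $H:\mathbb{N}\to\{0,1\}^*$ such that $H(n)$ has length $n$, $H(n+1)$ extends $H(n)$, and $\alpha\in\mathcal{F}(H(n))$ for all $n$. A function-oracle Turing machine is a multi-tape Turing machine with a special query tape and query/answer states: when it enters the query state with word $x$ on the query tape, the query tape content is replaced by $f(x)$ (where $f$ is the oracle), taking $|f(x)|$ steps; the input size of a query is the length of $x$. Numbers are written in binary, rationals $p/q$ by interleaving the binary representations of $p$ and $q$. -}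

module Defs where

open import Data.Bool using (Bool; true; false)
open import Data.Nat using (ℕ; zero; suc; _+_; _*_; _^_; _≤_; _⊔_; _%_; _/_; _≡ᵇ_)
open import Data.Fin using (Fin; zero; suc; _≟_)
open import Data.List using (List; []; _∷_; _++_; reverse; length; replicate)
open import Data.Vec using (Vec; lookup; map; zipWith; replicate)
open import Data.Product using (Σ; _×_; _,_; proj₁; proj₂; ∃)
open import Data.Integer using (+_)
open import Data.Rational using (ℚ; 0ℚ; 1ℚ) renaming (_<_ to _<ℚ_; _/_ to _÷_)
open import Relation.Nullary using (yes; no; ¬_)
open import Relation.Binary.PropositionalEquality using (_≡_)
open import Data.List.Relation.Unary.All using (All)

Word : Set
Word = List Bool          -- false = 0, true = 1

-- binary digits of n, least significant first (fuel-driven)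
binLSB : ℕ → ℕ → Word
binLSB zero    _ = []
binLSB (suc k) zero = []
binLSB (suc k) (suc n) = ((suc n % 2) ≡ᵇ 1) ∷ binLSB k (suc n / 2)

-- binary representation of n, most significant bit first (0 ↦ empty word)
bin : ℕ → Word
bin n = reverse (binLSB n n)

padTo : ℕ → Word → Word
padTo l w = Data.List.replicate (l Data.Nat.∸ length w) false ++ w

interleave : Word → Word → Word
interleave []       ys       = ys
interleave (x ∷ xs) []       = x ∷ xs
interleave (x ∷ xs) (y ∷ ys) = x ∷ y ∷ interleave xs ys

encQ : ℕ → ℕ → Word
encQ p q = interleave (padTo l (bin p)) (padTo l (bin q))
  where l = length (bin p) ⊔ length (bin q)

-- Dedekind cuts of irrationals in (0,1)
-- D q = false ("0") iff q < α, D q = true ("1") iff q > α.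

record IrrationalCutIn01 (D : ℚ → Bool) : Set where
  field
    upward   : ∀ q r → q <ℚ r → D q ≡ true → D r ≡ true
    noMaxLow : ∀ q → D q ≡ false → Σ ℚ λ r → q <ℚ r × D r ≡ false
    noMinUp  : ∀ q → D q ≡ true  → Σ ℚ λ r → r <ℚ q × D r ≡ true
    zeroLow  : D 0ℚ ≡ false
    oneUp    : D 1ℚ ≡ true

-- Farey pair tree.  A pair (a/b , c/d) is stored as (a , b-1 , c , d-1).

FareyPair : Set
FareyPair = ℕ × ℕ × ℕ × ℕ

fareyFrom : FareyPair → Word → FareyPair
fareyFrom p [] = p
fareyFrom (a , b , c , d) (false ∷ σ) = fareyFrom (a , b , a + c , b + suc d) σ
fareyFrom (a , b , c , d) (true  ∷ σ) = fareyFrom (a + c , b + suc d , c , d) σ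

farey : Word → FareyPair
farey = fareyFrom (0 , 0 , 1 , 0)

InFarey : (ℚ → Bool) → Word → Set
InFarey D σ with farey σ
... | (a , b , c , d) = (D (+ a ÷ suc b) ≡ false) × (D (+ c ÷ suc d) ≡ true)

Extends : Word → Word → Set
Extends τ σ = Σ Word λ ρ → τ ≡ σ ++ ρ

IsHurwitzChar : (ℚ → Bool) → (ℕ → Word) → Set
IsHurwitzChar D H =
  (∀ n → length (H n) ≡ n) × (∀ n → Extends (H (suc n)) (H n)) × (∀ n → InFarey D (H n))

-- Function-oracle multi-tape Turing machines.
-- Tape alphabet Fin (3 + m): zero = blank, 1 = symbol 0, 2 = symbol 1.
-- Tapes: 3 + w; tape 0 = input tape, tape 1 = query tape, tape 2 = output tape.

data Move : Set where
  L R S : Move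

Sym : ℕ → Set
Sym m = Fin (3 + m)

blank : ∀ {m} → Sym m
blank = zero

bitSym : ∀ {m} → Bool → Sym m
bitSym false = suc zero
bitSym true  = suc (suc zero)

record OTM : Set where
  field
    m      : ℕ
    w      : ℕ
    Q      : ℕ
    start  : Fin Q
    halt   : Fin Q
    qstate : Fin Q
    astate : Fin Q
    δ      : Fin Q → Vec (Sym m) (3 + w) → Fin Q × Vec (Sym m × Move) (3 + w)

-- a two-way infinite tape: cells left of the head (nearest first), head cell, cells to the right
record Tape (A : Set) : Set where
  constructor tape
  field
    left  : List A
    here  : A
    right : List A

moveTape : ∀ {m} → Move → Tape (Sym m) → Tape (Sym m)
moveTape L (tape []      h r) = tape [] blank (h ∷ r)
moveTape L (tape (x ∷ l) h r) = tape l x (h ∷ r)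
moveTape R (tape l h [])      = tape (h ∷ l) blank []
moveTape R (tape l h (x ∷ r)) = tape (h ∷ l) x r
moveTape S t = t

writeMove : ∀ {m} → Sym m × Move → Tape (Sym m) → Tape (Sym m)
writeMove (s , mv) (tape l h r) = moveTape mv (tape l s r)

tapeOf : ∀ {m} → Word → Tape (Sym m)
tapeOf []      = tape [] blank []
tapeOf (b ∷ u) = tape [] (bitSym b) (Data.List.map bitSym u)

dropBlanks : ∀ {m} → List (Sym m) → List (Sym m)
dropBlanks []                   = []
dropBlanks (zero ∷ xs)          = dropBlanks xs
dropBlanks (suc x ∷ xs)         = suc x ∷ xs

takeBits : ∀ {m} → List (Sym m) → Word
takeBits (suc zero ∷ xs)       = false ∷ takeBits xs
takeBits (suc (suc zero) ∷ xs) = true ∷ takeBits xs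
takeBits _                     = []

wordOn : ∀ {m} → Tape (Sym m) → Word
wordOn (tape l h r) = takeBits (dropBlanks (reverse l ++ h ∷ r))

record Config (M : OTM) : Set where
  constructor conf
  open OTM M
  field
    state : Fin Q
    tapes : Vec (Tape (Sym m)) (3 + w)

module _ (f : Word → Word) (M : OTM) where
  open OTM M

  queryTape : Vec (Tape (Sym m)) (3 + w) → Tape (Sym m)
  queryTape ts = lookup ts (suc zero)

  setQueryTape : Tape (Sym m) → Vec (Tape (Sym m)) (3 + w) → Vec (Tape (Sym m)) (3 + w)
  setQueryTape t (t0 Data.Vec.∷ _ Data.Vec.∷ ts) = t0 Data.Vec.∷ t Data.Vec.∷ ts

  -- one step: successor configuration, its cost, and the input sizes of queries made
  step : Config M → Config M × ℕ × List ℕ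
  step (conf q ts) with q ≟ qstate
  ... | yes _ = conf astate (setQueryTape (tapeOf (f x)) ts) , length (f x) , length x ∷ []
    where x = wordOn (queryTape ts)
  ... | no _ with δ q (Data.Vec.map Tape.here ts)
  ...   | (q' , acts) = conf q' (zipWith writeMove acts ts) , 1 , []

  initConfig : ℕ → Config M
  initConfig n = conf start (tapeOf (bin n) Data.Vec.∷ Data.Vec.replicate _ (tapeOf []))

  output : Config M → Word
  output (conf _ ts) = wordOn (lookup ts (suc (suc zero)))

  data Runs : Config M → ℕ → List ℕ → Config M → Set where
    stop : ∀ {c} → Config.state c ≡ halt → Runs c 0 [] c
    next : ∀ {c t qs c'} → ¬ (Config.state c ≡ halt) →
           Runs (proj₁ (step c)) t qs c' →
           Runs c (proj₁ (proj₂ (step c)) + t) (proj₂ (proj₂ (step c)) ++ qs) c'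

{-# OPTIONS --safe #-}
-- The machine keeps the Farey pair F(H(k)) = (a/b, c/d) on a work tape in binary, one cell
-- per bit position holding the bits of a, b, c, d and of the mediant a + c, b + d. A round
-- adds up the mediant (a + c)/(b + d) by ripple carry, writes numerator and denominator
-- interleaved on the query tape and asks D; since α lies right of the mediant exactly when
-- D answers 0, the negated answer is the next bit of H, and the corresponding half of the
-- pair is replaced by the mediant. At depth k all denominators are below 2 ^ (k + 1), so a
-- round takes O(n) steps and asks one query of size O(n) while k < n; the input n, counted
-- down in place, stops the machine after exactly n rounds, in time O(n ^ 2).
module Submission where

open import Defs
open import Data.Bool using (Bool; true; false; not; _xor_; _∧_; _∨_)
open import Data.Nat using (ℕ; zero; suc; _+_; _*_; _^_; _≤_; _<_; _∸_; _%_; _/_; _≡ᵇ_; _⊔_; z≤n; s≤s)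
open import Data.Nat.Properties hiding (_≟_)
open import Data.Nat.DivMod using (m≡m%n+[m/n]*n; [m+kn]%n≡m%n; m/n<m; m%n<n)
open import Data.Nat.Solver using (module +-*-Solver)
open import Data.Fin using (Fin; zero; suc; #_; toℕ; combine; remQuot; _≟_)
open import Data.Fin.Properties using (remQuot-combine)
open import Data.List using (List; []; _∷_; length; _++_; reverse; _ʳ++_; map; replicate)
open import Data.List.Properties using (map-cong; ++-assoc; ++-ʳ++; map-replicate; length-replicate; reverse-involutive; reverse-++; length-reverse; length-++; length-map; map-++; reverse-map; map-∘; ʳ++-defn; unfold-reverse)
open import Data.List.Relation.Unary.All using (All; []; _∷_)
open import Data.List.Relation.Unary.All.Properties using (map⁺)
open import Data.Vec using (Vec; zipWith) renaming (_∷_ to _∷ᵥ_; [] to []ᵥ)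
open import Data.Product using (Σ; ∃₂; _×_; _,_; proj₁; proj₂; map₁)
open import Data.Sum using (_⊎_; inj₁; inj₂)
open import Data.Unit using (⊤)
open import Data.Empty using (⊥; ⊥-elim)
open import Data.Integer using (+_)
open import Data.Rational using (ℚ) renaming (_/_ to _÷_)
open import Relation.Nullary using (yes; no; ¬_)
open import Relation.Binary.PropositionalEquality
open +-*-Solver

replicate-++-∷ : ∀ {A : Set} j (x : A) r → replicate j x ++ x ∷ r ≡ x ∷ replicate j x ++ r
replicate-++-∷ zero    x r = refl
replicate-++-∷ (suc j) x r = cong (x ∷_) (replicate-++-∷ j x r)

replicate-ʳ++ : ∀ {A : Set} j (x : A) acc → replicate j x ʳ++ acc ≡ replicate j x ++ acc
replicate-ʳ++ zero    x acc = refl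
replicate-ʳ++ (suc j) x acc = trans (replicate-ʳ++ j x (x ∷ acc)) (replicate-++-∷ j x acc)

All-reverse : ∀ {A : Set} {P : A → Set} {xs} → All P xs → All P (reverse xs)
All-reverse {P = P} = go [] []
  where
  go : ∀ {xs} acc → All P acc → All P xs → All P (xs ʳ++ acc)
  go acc pacc []         = pacc
  go acc pacc (px ∷ pxs) = go (_ ∷ acc) (px ∷ pacc) pxs

bitValue : Bool → ℕ
bitValue false = 0
bitValue true  = 1

-- Least significant bit first, as on the machine's work tape.
fromBits : List Bool → ℕ
fromBits []       = 0
fromBits (b ∷ bs) = bitValue b + fromBits bs * 2

bitValue≤1 : ∀ b → bitValue b ≤ 1
bitValue≤1 false = z≤n
bitValue≤1 true  = s≤s z≤n

fromBits-++ : ∀ bs cs → fromBits (bs ++ cs) ≡ fromBits bs + 2 ^ length bs * fromBits cs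
fromBits-++ []       cs = sym (+-identityʳ (fromBits cs))
fromBits-++ (b ∷ bs) cs rewrite fromBits-++ bs cs =
  solve 4 (λ b v p c → b :+ (v :+ p :* c) :* con 2 := (b :+ v :* con 2) :+ (con 2 :* p) :* c) refl
    (bitValue b) (fromBits bs) (2 ^ length bs) (fromBits cs)

fromBits<2^length : ∀ bs → fromBits bs < 2 ^ length bs
fromBits<2^length []       = s≤s z≤n
fromBits<2^length (b ∷ bs) = begin-strict
  bitValue b + fromBits bs * 2  <⟨ s≤s (+-monoˡ-≤ (fromBits bs * 2) (bitValue≤1 b)) ⟩
  suc (fromBits bs) * 2         ≤⟨ *-monoˡ-≤ 2 (fromBits<2^length bs) ⟩
  2 ^ length bs * 2             ≡⟨ *-comm (2 ^ length bs) 2 ⟩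
  2 ^ suc (length bs)           ∎
  where open ≤-Reasoning

<2^suc : ∀ {k x} → x < 2 ^ k → x < 2 ^ suc k
<2^suc {k} x< = ≤-trans x< (m≤m+n (2 ^ k) (2 ^ k + 0))

sum<2^suc : ∀ {k x y} → x < 2 ^ k → y < 2 ^ k → x + y < 2 ^ suc k
sum<2^suc {k} {x} {y} x< y< = subst (x + y <_) (cong (λ m → 2 ^ k + m) (sym (+-identityʳ (2 ^ k)))) (+-mono-< x< y<)

fromBits-allFalse : ∀ {bs} → All (_≡ false) bs → fromBits bs ≡ 0
fromBits-allFalse []           = refl
fromBits-allFalse (refl ∷ bs0) rewrite fromBits-allFalse bs0 = refl

fromBits-++-highZero : ∀ lo {hi} → fromBits hi ≡ 0 → fromBits (lo ++ hi) ≡ fromBits lo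
fromBits-++-highZero lo {hi} hi≡0 = begin
  fromBits (lo ++ hi)                          ≡⟨ fromBits-++ lo hi ⟩
  fromBits lo + 2 ^ length lo * fromBits hi    ≡⟨ cong (λ v → fromBits lo + 2 ^ length lo * v) hi≡0 ⟩
  fromBits lo + 2 ^ length lo * 0              ≡⟨ cong (λ m → fromBits lo + m) (*-zeroʳ (2 ^ length lo)) ⟩
  fromBits lo + 0                              ≡⟨ +-identityʳ (fromBits lo) ⟩
  fromBits lo                                  ∎
  where open ≡-Reasoning

fromBits-++-small : ∀ lo hi → fromBits (lo ++ hi) < 2 ^ length lo → fromBits (lo ++ hi) ≡ fromBits lo
fromBits-++-small lo hi small with fromBits hi in hi≡
... | zero  = fromBits-++-highZero lo hi≡
... | suc h = ⊥-elim (<⇒≱ small (begin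
  2 ^ length lo                                ≤⟨ m≤m*n (2 ^ length lo) (suc h) ⟩
  2 ^ length lo * suc h                        ≤⟨ m≤n+m _ (fromBits lo) ⟩
  fromBits lo + 2 ^ length lo * suc h          ≡⟨ cong (λ v → fromBits lo + 2 ^ length lo * v) hi≡ ⟨
  fromBits lo + 2 ^ length lo * fromBits hi    ≡⟨ fromBits-++ lo hi ⟨
  fromBits (lo ++ hi)                          ∎))
  where open ≤-Reasoning

fromBits≡0⇒replicate : ∀ bs → fromBits bs ≡ 0 → bs ≡ replicate (length bs) false
fromBits≡0⇒replicate []           _  = refl
fromBits≡0⇒replicate (false ∷ bs) eq = cong (false ∷_) (fromBits≡0⇒replicate bs (m*n≡0⇒m≡0 (fromBits bs) 2 eq))

-- Decrementing a little-endian counter turns its initial segment 0…01 into 1…10.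
fromBits≡suc⇒view : ∀ bs {v} → fromBits bs ≡ suc v → ∃₂ λ j rest → bs ≡ replicate j false ++ true ∷ rest
fromBits≡suc⇒view (true ∷ bs)  _  = 0 , bs , refl
fromBits≡suc⇒view (false ∷ bs) eq with fromBits bs in bs≡
... | zero  = ⊥-elim (0≢1+n eq)
... | suc w with j , rest , refl ← fromBits≡suc⇒view bs bs≡ = suc j , rest , refl

fromBits-decrement : ∀ j rest → suc (fromBits (replicate j true ++ false ∷ rest)) ≡ fromBits (replicate j false ++ true ∷ rest)
fromBits-decrement zero    rest = refl
fromBits-decrement (suc j) rest rewrite sym (fromBits-decrement j rest) = refl

length-decrement : ∀ j rest → length (replicate j true ++ false ∷ rest) ≡ length (replicate j false ++ true ∷ rest)
length-decrement zero    rest = refl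
length-decrement (suc j) rest = cong suc (length-decrement j rest)

data MsbSet : List Bool → Set where
  [1]    : MsbSet (true ∷ [])
  _∷msb_ : ∀ b {bs} → MsbSet bs → MsbSet (b ∷ bs)

1≤fromBits : ∀ {bs} → MsbSet bs → 1 ≤ fromBits bs
1≤fromBits [1]                = s≤s z≤n
1≤fromBits (_∷msb_ b {bs} msb) = ≤-trans (≤-trans (1≤fromBits msb) (m≤m*n (fromBits bs) 2)) (m≤n+m _ (bitValue b))

lowBit-fromBits : ∀ b m → ((bitValue b + m * 2) % 2 ≡ᵇ 1) ≡ b
lowBit-fromBits false m = cong (_≡ᵇ 1) ([m+kn]%n≡m%n 0 m 2)
lowBit-fromBits true  m = cong (_≡ᵇ 1) ([m+kn]%n≡m%n 1 m 2)

shift-fromBits : ∀ b m → (bitValue b + m * 2) / 2 ≡ m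
shift-fromBits b m = *-cancelʳ-≡ _ _ 2 (+-cancelˡ-≡ (bitValue b) _ _ (sym (begin
  x                           ≡⟨ m≡m%n+[m/n]*n x 2 ⟩
  x % 2 + x / 2 * 2           ≡⟨ cong (_+ x / 2 * 2) ([m+kn]%n≡m%n (bitValue b) m 2) ⟩
  bitValue b % 2 + x / 2 * 2  ≡⟨ cong (_+ x / 2 * 2) (lowBit b) ⟩
  bitValue b + x / 2 * 2      ∎)))
  where
  open ≡-Reasoning
  x : ℕ
  x = bitValue b + m * 2
  lowBit : ∀ b → bitValue b % 2 ≡ bitValue b
  lowBit false = refl
  lowBit true  = refl

binLSB-suc : ∀ k x → 1 ≤ x → binLSB (suc k) x ≡ ((x % 2) ≡ᵇ 1) ∷ binLSB k (x / 2)
binLSB-suc k (suc x) _ = refl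

binLSB-zero : ∀ k → binLSB k 0 ≡ []
binLSB-zero zero    = refl
binLSB-zero (suc k) = refl

binLSB-fromBits : ∀ {bs} → MsbSet bs → ∀ k → fromBits bs ≤ k → binLSB k (fromBits bs) ≡ bs
binLSB-fromBits msb zero le = ⊥-elim (<⇒≱ (≤-trans (1≤fromBits msb) le) z≤n)
binLSB-fromBits {b ∷ bs} msb (suc k) le =
  trans (binLSB-suc k (fromBits (b ∷ bs)) (1≤fromBits msb))
    (cong₂ _∷_ (lowBit-fromBits b (fromBits bs))
      (trans (cong (binLSB k) (shift-fromBits b (fromBits bs))) (higher msb)))
  where
  higher : MsbSet (b ∷ bs) → binLSB k (fromBits bs) ≡ bs
  higher [1]           = binLSB-zero k
  higher (_ ∷msb msb′) = binLSB-fromBits msb′ k (half (1≤fromBits msb′) (≤-trans (m≤n+m _ (bitValue b)) le))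
    where
    half : ∀ {v} → 1 ≤ v → v * 2 ≤ suc k → v ≤ k
    half {suc v} _ (s≤s le) = ≤-trans (s≤s (m≤m*n v 2)) le

fromBits-binLSB : ∀ k x → x ≤ k → fromBits (binLSB k x) ≡ x
fromBits-binLSB zero    zero    _  = refl
fromBits-binLSB (suc k) zero    _  = refl
fromBits-binLSB (suc k) (suc x) le = begin
  bitValue ((suc x % 2) ≡ᵇ 1) + fromBits (binLSB k (suc x / 2)) * 2
    ≡⟨ cong₂ (λ a c → a + c * 2) (bitValue-lowBit (suc x)) (fromBits-binLSB k (suc x / 2) half≤k) ⟩
  suc x % 2 + suc x / 2 * 2
    ≡⟨ m≡m%n+[m/n]*n (suc x) 2 ⟨
  suc x ∎
  where
  open ≡-Reasoning
  half≤k : suc x / 2 ≤ k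
  half≤k = ≤-pred (≤-trans (m/n<m (suc x) 2 (s≤s (s≤s z≤n))) le)
  bitValue-lowBit : ∀ x → bitValue ((x % 2) ≡ᵇ 1) ≡ x % 2
  bitValue-lowBit x with x % 2 | m%n<n x 2
  ... | zero  | _ = refl
  ... | suc zero | _ = refl
  ... | suc (suc _) | s≤s (s≤s ())

length-binLSB : ∀ k x → length (binLSB k x) ≤ k
length-binLSB zero    x       = z≤n
length-binLSB (suc k) zero    = z≤n
length-binLSB (suc k) (suc x) = s≤s (length-binLSB k (suc x / 2))

-- `bin` is most significant bit first, so it reads fromBits backwards.
bin-fromBits : ∀ w → MsbSet (reverse w) → bin (fromBits (reverse w)) ≡ w
bin-fromBits w msb = trans (cong reverse (binLSB-fromBits msb _ ≤-refl)) (reverse-involutive w)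

msbSet-∷ʳ : ∀ bs → MsbSet (bs ++ true ∷ [])
msbSet-∷ʳ []       = [1]
msbSet-∷ʳ (b ∷ bs) = b ∷msb msbSet-∷ʳ bs

msbSet-reverse : ∀ bs → MsbSet (reverse (true ∷ bs))
msbSet-reverse bs = subst MsbSet (sym (unfold-reverse true bs)) (msbSet-∷ʳ (reverse bs))

length≤-padded : ∀ {l w u} → padTo l w ≡ u → length w ≤ length u
length≤-padded {l} {w} refl =
  subst (length w ≤_) (sym (trans (length-++ (replicate (l ∸ length w) false)) (cong (_+ length w) (length-replicate (l ∸ length w)))))
    (m≤n+m (length w) (l ∸ length w))

padTo-id : ∀ w → padTo (length w) w ≡ w
padTo-id w rewrite n∸n≡0 (length w) = refl

padTo-suc : ∀ l w → length w ≤ l → padTo (suc l) w ≡ false ∷ padTo l w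
padTo-suc l w le rewrite +-∸-assoc 1 le = refl

-- Leading zeros are exactly what `bin` drops and `padTo` restores.
padTo-bin-fromBits : ∀ u → padTo (length u) (bin (fromBits (reverse u))) ≡ u
padTo-bin-fromBits []        = refl
padTo-bin-fromBits (true ∷ u) =
  trans (cong (padTo (suc (length u))) (bin-fromBits (true ∷ u) (msbSet-reverse u))) (padTo-id (true ∷ u))
padTo-bin-fromBits (false ∷ u) rewrite unfold-reverse false u | fromBits-++-highZero (reverse u) {false ∷ []} refl =
  trans (padTo-suc (length u) w (length≤-padded {length u} {w} (padTo-bin-fromBits u))) (cong (false ∷_) (padTo-bin-fromBits u))
  where w = bin (fromBits (reverse u))

encQ-fromBits : ∀ us vs → length us ≡ length vs → MsbSet (reverse vs) →
  encQ (fromBits (reverse us)) (fromBits (reverse vs)) ≡ interleave us vs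
encQ-fromBits us vs len msb rewrite bin-fromBits vs msb =
  cong₂ interleave
    (trans (cong (λ l → padTo l w) (trans width (sym len))) (padTo-bin-fromBits us))
    (trans (cong (λ l → padTo l vs) width) (padTo-id vs))
  where
  w : Word
  w = bin (fromBits (reverse us))
  width : length w ⊔ length vs ≡ length vs
  width = m≤n⇒m⊔n≡n (subst (length w ≤_) len (length≤-padded {length us} {w} (padTo-bin-fromBits us)))

-- (sum, carry)
fullAdd : Bool → Bool → Bool → Bool × Bool
fullAdd c x y = c xor (x xor y) , (x ∧ y) ∨ (c ∧ (x xor y))

fullAdd-correct : ∀ c x y → bitValue (proj₁ (fullAdd c x y)) + bitValue (proj₂ (fullAdd c x y)) * 2 ≡ bitValue c + bitValue x + bitValue y
fullAdd-correct false false false = refl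
fullAdd-correct false false true  = refl
fullAdd-correct false true  false = refl
fullAdd-correct false true  true  = refl
fullAdd-correct true  false false = refl
fullAdd-correct true  false true  = refl
fullAdd-correct true  true  false = refl
fullAdd-correct true  true  true  = refl

-- The final carry is dropped, so the result is the sum only when it fits.
rippleAdd : Bool → List Bool → List Bool → List Bool
rippleAdd c (x ∷ xs) (y ∷ ys) = proj₁ (fullAdd c x y) ∷ rippleAdd (proj₂ (fullAdd c x y)) xs ys
rippleAdd c _        _        = []

fromBits-rippleAdd : ∀ c xs ys → length xs ≡ length ys → bitValue c + fromBits xs + fromBits ys < 2 ^ length xs →
  fromBits (rippleAdd c xs ys) ≡ bitValue c + fromBits xs + fromBits ys
fromBits-rippleAdd false [] [] _ _ = refl
fromBits-rippleAdd true  [] [] _ (s≤s ())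
fromBits-rippleAdd c (x ∷ xs) (y ∷ ys) len fits =
  trans (cong (λ v → bitValue s + v * 2) (fromBits-rippleAdd c′ xs ys (suc-injective len) (*-cancelʳ-< 2 _ _ fits′))) (sym split)
  where
  s : Bool
  s = proj₁ (fullAdd c x y)
  c′ : Bool
  c′ = proj₂ (fullAdd c x y)
  X : ℕ
  X = fromBits xs
  Y : ℕ
  Y = fromBits ys
  split : bitValue c + (bitValue x + X * 2) + (bitValue y + Y * 2) ≡ bitValue s + (bitValue c′ + X + Y) * 2
  split = begin
    bitValue c + (bitValue x + X * 2) + (bitValue y + Y * 2)
      ≡⟨ solve 5 (λ c x y X Y → c :+ (x :+ X :* con 2) :+ (y :+ Y :* con 2) := (c :+ x :+ y) :+ (X :+ Y) :* con 2) refl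
           (bitValue c) (bitValue x) (bitValue y) X Y ⟩
    (bitValue c + bitValue x + bitValue y) + (X + Y) * 2
      ≡⟨ cong (_+ (X + Y) * 2) (fullAdd-correct c x y) ⟨
    (bitValue s + bitValue c′ * 2) + (X + Y) * 2
      ≡⟨ solve 4 (λ s c X Y → (s :+ c :* con 2) :+ (X :+ Y) :* con 2 := s :+ (c :+ X :+ Y) :* con 2) refl
           (bitValue s) (bitValue c′) X Y ⟩
    bitValue s + (bitValue c′ + X + Y) * 2 ∎
    where open ≡-Reasoning
  fits′ : (bitValue c′ + X + Y) * 2 < 2 ^ length xs * 2
  fits′ = begin-strict
    (bitValue c′ + X + Y) * 2               ≤⟨ m≤n+m _ (bitValue s) ⟩
    bitValue s + (bitValue c′ + X + Y) * 2  ≡⟨ split ⟨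
    _                                       <⟨ fits ⟩
    2 * 2 ^ length xs                       ≡⟨ *-comm 2 (2 ^ length xs) ⟩
    2 ^ length xs * 2                       ∎
    where open ≤-Reasoning

leftNum leftDen rightNum rightDen : FareyPair → ℕ
leftNum  (a , _ , _ , _) = a
leftDen  (_ , b , _ , _) = suc b
rightNum (_ , _ , c , _) = c
rightDen (_ , _ , _ , d) = suc d

mediantNum mediantDen : FareyPair → ℕ
mediantNum p = leftNum p + rightNum p
mediantDen p = leftDen p + rightDen p

farey-∷ʳ : ∀ σ β → farey (σ ++ β ∷ []) ≡ fareyFrom (farey σ) (β ∷ [])
farey-∷ʳ = go (0 , 0 , 1 , 0)
  where
  go : ∀ p σ β → fareyFrom p (σ ++ β ∷ []) ≡ fareyFrom (fareyFrom p σ) (β ∷ [])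
  go p                 []          β = refl
  go (a , b , c , d) (false ∷ σ) β = go _ σ β
  go (a , b , c , d) (true  ∷ σ) β = go _ σ β

FareyBounded : ℕ → FareyPair → Set
FareyBounded k p =
  (leftDen p < 2 ^ suc k) × (rightDen p < 2 ^ suc k) × (leftNum p ≤ leftDen p) × (rightNum p ≤ rightDen p)

fareyChild-bounded : ∀ {k} p β → FareyBounded k p → FareyBounded (suc k) (fareyFrom p (β ∷ []))
fareyChild-bounded {k} (a , b , c , d) false (lb , rb , lle , rle) =
  <2^suc {suc k} lb , sum<2^suc {suc k} lb rb , lle , +-mono-≤ lle rle
fareyChild-bounded {k} (a , b , c , d) true  (lb , rb , lle , rle) =
  sum<2^suc {suc k} lb rb , <2^suc {suc k} rb , +-mono-≤ lle rle , rle

module _ (D : ℚ → Bool) where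

  mediantBit : FareyPair → Bool
  mediantBit p = not (D (+ mediantNum p ÷ mediantDen p))

  hurwitz : ℕ → Word
  hurwitz zero    = []
  hurwitz (suc k) = hurwitz k ++ mediantBit (farey (hurwitz k)) ∷ []

  Brackets : FareyPair → Set
  Brackets p = (D (+ leftNum p ÷ leftDen p) ≡ false) × (D (+ rightNum p ÷ rightDen p) ≡ true)

  brackets-mediantChild : ∀ p → Brackets p → Brackets (fareyFrom p (mediantBit p ∷ []))
  brackets-mediantChild p@(a , b , c , d) (below , above) = bySide _ refl
    where
    bySide : ∀ side → D (+ mediantNum p ÷ mediantDen p) ≡ side → Brackets (fareyFrom p (not side ∷ []))
    bySide false med = med , above
    bySide true  med = below , med

  length-hurwitz : ∀ k → length (hurwitz k) ≡ k
  length-hurwitz zero    = refl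
  length-hurwitz (suc k) = trans (length-++ (hurwitz k)) (trans (+-comm (length (hurwitz k)) 1) (cong suc (length-hurwitz k)))

  brackets-hurwitz : IrrationalCutIn01 D → ∀ k → Brackets (farey (hurwitz k))
  brackets-hurwitz cut zero    = IrrationalCutIn01.zeroLow cut , IrrationalCutIn01.oneUp cut
  brackets-hurwitz cut (suc k) =
    subst Brackets (sym (farey-∷ʳ (hurwitz k) _)) (brackets-mediantChild (farey (hurwitz k)) (brackets-hurwitz cut k))

  hurwitz-isHurwitzChar : IrrationalCutIn01 D → IsHurwitzChar D hurwitz
  hurwitz-isHurwitzChar cut = length-hurwitz , (λ k → _ , refl) , brackets-hurwitz cut

  hurwitz-bounded : ∀ k → FareyBounded k (farey (hurwitz k))
  hurwitz-bounded zero    = s≤s (s≤s z≤n) , s≤s (s≤s z≤n) , z≤n , s≤s z≤n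
  hurwitz-bounded (suc k) = subst (FareyBounded (suc k)) (sym (farey-∷ʳ (hurwitz k) β)) (fareyChild-bounded {k} (farey (hurwitz k)) β (hurwitz-bounded k))
    where β = mediantBit (farey (hurwitz k))

-- One cell of the work tape holds the bits of equal weight of the six numbers
-- a, b, c, d (the Farey pair a/b, c/d) and a + c, b + d (its mediant).
record Column : Set where
  constructor column
  field
    lNum lDen rNum rDen mNum mDen : Bool
open Column public

data Cell : Set where
  □   : Cell
  bit : Bool → Cell
  col : Column → Cell

data State : Set where
  ScanInput PutFirstColumn PutZeroColumn Decrement SeekCounterEnd : State
  Add : Bool → Bool → State
  SkipZeroColumns EmitNum EmitDen Query Answer : State
  Replace : Bool → State
  Rewind Halt : State

record Instruction : Set where
  constructor instr
  field
    nextState : State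
    onCounter onQuery onOutput onWork : Cell × Move

stay : Cell → Cell × Move
stay h = h , S

halt : Cell → Cell → Cell → Cell → Instruction
halt h₀ h₁ h₂ h₃ = instr Halt (stay h₀) (stay h₁) (stay h₂) (stay h₃)

zeroColumn : Column
zeroColumn = column false false false false false false

-- The bits of weight 1 of the root pair 0/1, 1/1; all higher bits are those of zeroColumn.
rootColumn : Column
rootColumn = column false true true true false false

addColumn : Bool → Bool → Column → Column × Bool × Bool
addColumn c₁ c₂ x =
  column (lNum x) (lDen x) (rNum x) (rDen x) (proj₁ num) (proj₁ den) , proj₂ num , proj₂ den
  where
  num : Bool × Bool
  num = fullAdd c₁ (lNum x) (rNum x)
  den : Bool × Bool
  den = fullAdd c₂ (lDen x) (rDen x)

addColumns : Bool → Bool → List Column → List Column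
addColumns c₁ c₂ []       = []
addColumns c₁ c₂ (x ∷ xs) = let (x′ , c₁′ , c₂′) = addColumn c₁ c₂ x in x′ ∷ addColumns c₁′ c₂′ xs

emitted : List Column → Word
emitted cs = interleave (map mNum cs) (map mDen cs)

-- Replace true moves to the right half (a/b := mediant), Replace false to the left half.
replace : Bool → Column → Column
replace true  x = column (mNum x) (mDen x) (rNum x) (rDen x) (mNum x) (mDen x)
replace false x = column (lNum x) (lDen x) (mNum x) (mDen x) (mNum x) (mDen x)

-- Tapes: counter (the input n, counted down in place), query, output, work.
transition : State → Cell → Cell → Cell → Cell → Instruction
transition ScanInput (bit b) h₁ h₂ h₃ = instr ScanInput (bit b , R) (stay h₁) (stay h₂) (stay h₃)
transition ScanInput □ h₁ h₂ h₃ = instr PutFirstColumn (□ , L) (stay h₁) (stay h₂) (stay h₃)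
transition ScanInput (col x) h₁ h₂ h₃ = halt (col x) h₁ h₂ h₃
transition PutFirstColumn h₀ h₁ h₂ h₃ = instr PutZeroColumn (stay h₀) (stay h₁) (stay h₂) (col rootColumn , R)
transition PutZeroColumn h₀ h₁ h₂ h₃ = instr Decrement (stay h₀) (stay h₁) (stay h₂) (col zeroColumn , L)
transition Decrement (bit false) h₁ h₂ h₃ = instr Decrement (bit true , L) (stay h₁) (stay h₂) (stay h₃)
transition Decrement (bit true) h₁ h₂ h₃ = instr SeekCounterEnd (bit false , R) (stay h₁) (stay h₂) (stay h₃)
transition Decrement □ h₁ h₂ h₃ = halt □ h₁ h₂ h₃
transition Decrement (col x) h₁ h₂ h₃ = halt (col x) h₁ h₂ h₃
transition SeekCounterEnd (bit b) h₁ h₂ h₃ = instr SeekCounterEnd (bit b , R) (stay h₁) (stay h₂) (stay h₃)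
transition SeekCounterEnd □ h₁ h₂ h₃ = instr (Add false false) (□ , L) (stay h₁) (stay h₂) (stay h₃)
transition SeekCounterEnd (col x) h₁ h₂ h₃ = halt (col x) h₁ h₂ h₃
transition (Add c₁ c₂) h₀ h₁ h₂ (col x) with addColumn c₁ c₂ x
... | x′ , c₁′ , c₂′ = instr (Add c₁′ c₂′) (stay h₀) (stay h₁) (stay h₂) (col x′ , R)
transition (Add c₁ c₂) h₀ h₁ h₂ □ = instr SkipZeroColumns (stay h₀) (stay h₁) (stay h₂) (□ , L)
transition (Add c₁ c₂) h₀ h₁ h₂ (bit b) = halt h₀ h₁ h₂ (bit b)
transition SkipZeroColumns h₀ h₁ h₂ (col x) with mDen x
... | false = instr SkipZeroColumns (stay h₀) (stay h₁) (stay h₂) (col x , L)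
... | true  = instr EmitDen (stay h₀) (bit (mNum x) , R) (stay h₂) (stay (col x))
transition SkipZeroColumns h₀ h₁ h₂ □ = halt h₀ h₁ h₂ □
transition SkipZeroColumns h₀ h₁ h₂ (bit b) = halt h₀ h₁ h₂ (bit b)
transition EmitDen h₀ h₁ h₂ (col x) = instr EmitNum (stay h₀) (bit (mDen x) , R) (stay h₂) (col x , L)
transition EmitDen h₀ h₁ h₂ □ = halt h₀ h₁ h₂ □
transition EmitDen h₀ h₁ h₂ (bit b) = halt h₀ h₁ h₂ (bit b)
transition EmitNum h₀ h₁ h₂ (col x) = instr EmitDen (stay h₀) (bit (mNum x) , R) (stay h₂) (stay (col x))
transition EmitNum h₀ h₁ h₂ □ = instr Query (stay h₀) (stay h₁) (stay h₂) (□ , R)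
transition EmitNum h₀ h₁ h₂ (bit b) = halt h₀ h₁ h₂ (bit b)
transition Query h₀ h₁ h₂ h₃ = halt h₀ h₁ h₂ h₃
transition Answer h₀ (bit d) h₂ h₃ = instr (Replace (not d)) (stay h₀) (stay (bit d)) (bit (not d) , R) (stay h₃)
transition Answer h₀ □ h₂ h₃ = halt h₀ □ h₂ h₃
transition Answer h₀ (col x) h₂ h₃ = halt h₀ (col x) h₂ h₃
transition (Replace β) h₀ h₁ h₂ (col x) = instr (Replace β) (stay h₀) (stay h₁) (stay h₂) (col (replace β x) , R)
transition (Replace β) h₀ h₁ h₂ □ = instr Rewind (stay h₀) (stay h₁) (stay h₂) (col zeroColumn , L)
transition (Replace β) h₀ h₁ h₂ (bit b) = halt h₀ h₁ h₂ (bit b)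
transition Rewind h₀ h₁ h₂ (col x) = instr Rewind (stay h₀) (stay h₁) (stay h₂) (col x , L)
transition Rewind h₀ h₁ h₂ □ = instr Decrement (stay h₀) (stay h₁) (stay h₂) (□ , R)
transition Rewind h₀ h₁ h₂ (bit b) = halt h₀ h₁ h₂ (bit b)
transition Halt h₀ h₁ h₂ h₃ = halt h₀ h₁ h₂ h₃

stateIndex : State → Fin 18
stateIndex ScanInput             = # 0
stateIndex PutFirstColumn        = # 1
stateIndex PutZeroColumn         = # 2
stateIndex Decrement             = # 3
stateIndex SeekCounterEnd        = # 4
stateIndex (Add false false)     = # 5
stateIndex (Add false true)      = # 6
stateIndex (Add true false)      = # 7
stateIndex (Add true true)       = # 8
stateIndex SkipZeroColumns       = # 9
stateIndex EmitNum               = # 10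
stateIndex EmitDen               = # 11
stateIndex Query                 = # 12
stateIndex Answer                = # 13
stateIndex (Replace false)       = # 14
stateIndex (Replace true)        = # 15
stateIndex Rewind                = # 16
stateIndex Halt                  = # 17

stateAt : Fin 18 → State
stateAt i = go (toℕ i)
  where
  go : ℕ → State
  go 0  = ScanInput
  go 1  = PutFirstColumn
  go 2  = PutZeroColumn
  go 3  = Decrement
  go 4  = SeekCounterEnd
  go 5  = Add false false
  go 6  = Add false true
  go 7  = Add true false
  go 8  = Add true true
  go 9  = SkipZeroColumns
  go 10 = EmitNum
  go 11 = EmitDen
  go 12 = Query
  go 13 = Answer
  go 14 = Replace false
  go 15 = Replace true
  go 16 = Rewind
  go _  = Halt

stateAt-index : ∀ s → stateAt (stateIndex s) ≡ s
stateAt-index ScanInput         = refl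
stateAt-index PutFirstColumn    = refl
stateAt-index PutZeroColumn     = refl
stateAt-index Decrement         = refl
stateAt-index SeekCounterEnd    = refl
stateAt-index (Add false false) = refl
stateAt-index (Add false true)  = refl
stateAt-index (Add true false)  = refl
stateAt-index (Add true true)   = refl
stateAt-index SkipZeroColumns   = refl
stateAt-index EmitNum           = refl
stateAt-index EmitDen           = refl
stateAt-index Query             = refl
stateAt-index Answer            = refl
stateAt-index (Replace false)   = refl
stateAt-index (Replace true)    = refl
stateAt-index Rewind            = refl
stateAt-index Halt              = refl

stateIndex-injective : ∀ {s s′} → stateIndex s ≡ stateIndex s′ → s ≡ s′
stateIndex-injective {s} {s′} eq = trans (sym (stateAt-index s)) (trans (cong stateAt eq) (stateAt-index s′))

pushBit : ∀ {n} → Bool → Fin n → Fin (2 * n)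
pushBit false i = combine {2} zero i
pushBit true  i = combine {2} (suc zero) i

isOne : Fin 2 → Bool
isOne zero    = false
isOne (suc _) = true

opaque
  popBit : ∀ {n} → Fin (2 * n) → Bool × Fin n
  popBit {n} k = map₁ isOne (remQuot n k)

  popBit-pushBit : ∀ {n} b (i : Fin n) → popBit (pushBit b i) ≡ (b , i)
  popBit-pushBit false i = cong (map₁ isOne) (remQuot-combine {2} zero i)
  popBit-pushBit true  i = cong (map₁ isOne) (remQuot-combine {2} (suc zero) i)

columnCode : Column → Fin 64
columnCode (column a b c d p q) = pushBit a (pushBit b (pushBit c (pushBit d (pushBit p (pushBit q (zero {0}))))))

columnAt : Fin 64 → Column
columnAt k₀ =
  let (a , k₁) = popBit k₀; (b , k₂) = popBit k₁; (c , k₃) = popBit k₂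
      (d , k₄) = popBit k₃; (p , k₅) = popBit k₄; (q , _)  = popBit {1} k₅
  in column a b c d p q

columnAt-code : ∀ x → columnAt (columnCode x) ≡ x
columnAt-code (column a b c d p q)
  rewrite popBit-pushBit a (pushBit b (pushBit c (pushBit d (pushBit p (pushBit q (zero {0}))))))
        | popBit-pushBit b (pushBit c (pushBit d (pushBit p (pushBit q (zero {0})))))
        | popBit-pushBit c (pushBit d (pushBit p (pushBit q (zero {0}))))
        | popBit-pushBit d (pushBit p (pushBit q (zero {0})))
        | popBit-pushBit p (pushBit q (zero {0}))
        | popBit-pushBit q (zero {0}) = refl

toSym : Cell → Sym 64
toSym □       = zero
toSym (bit b) = bitSym b
toSym (col x) = suc (suc (suc (columnCode x)))

fromSym : Sym 64 → Cell
fromSym zero                = □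
fromSym (suc zero)          = bit false
fromSym (suc (suc zero))    = bit true
fromSym (suc (suc (suc k))) = col (columnAt k)

fromSym-toSym : ∀ c → fromSym (toSym c) ≡ c
fromSym-toSym □           = refl
fromSym-toSym (bit false) = refl
fromSym-toSym (bit true)  = refl
fromSym-toSym (col x)     = cong col (columnAt-code x)

encodeAction : Cell × Move → Sym 64 × Move
encodeAction (c , mv) = toSym c , mv

encodeInstruction : Instruction → Fin 18 × Vec (Sym 64 × Move) 4
encodeInstruction (instr s a₀ a₁ a₂ a₃) =
  stateIndex s , (encodeAction a₀ ∷ᵥ encodeAction a₁ ∷ᵥ encodeAction a₂ ∷ᵥ encodeAction a₃ ∷ᵥ []ᵥ)

δ : Fin 18 → Vec (Sym 64) 4 → Fin 18 × Vec (Sym 64 × Move) 4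
δ q (h₀ ∷ᵥ h₁ ∷ᵥ h₂ ∷ᵥ h₃ ∷ᵥ []ᵥ) = encodeInstruction (transition (stateAt q) (fromSym h₀) (fromSym h₁) (fromSym h₂) (fromSym h₃))

hurwitzMachine : OTM
hurwitzMachine = record
  { m = 64 ; w = 1 ; Q = 18 ; start = stateIndex ScanInput ; halt = stateIndex Halt
  ; qstate = stateIndex Query ; astate = stateIndex Answer ; δ = δ }

moveCell : Move → Tape Cell → Tape Cell
moveCell L (tape []      h r) = tape [] □ (h ∷ r)
moveCell L (tape (x ∷ l) h r) = tape l x (h ∷ r)
moveCell R (tape l h [])      = tape (h ∷ l) □ []
moveCell R (tape l h (x ∷ r)) = tape (h ∷ l) x r
moveCell S t = t

act : Cell × Move → Tape Cell → Tape Cell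
act (s , mv) (tape l h r) = moveCell mv (tape l s r)

encodeTape : Tape Cell → Tape (Sym 64)
encodeTape (tape l h r) = tape (map toSym l) (toSym h) (map toSym r)

writeMove-encode : ∀ a t → writeMove (encodeAction a) (encodeTape t) ≡ encodeTape (act a t)
writeMove-encode (c , L) (tape [] h r)      = refl
writeMove-encode (c , L) (tape (x ∷ l) h r) = refl
writeMove-encode (c , R) (tape l h [])      = refl
writeMove-encode (c , R) (tape l h (x ∷ r)) = refl
writeMove-encode (c , S) (tape l h r)       = refl

record CellConfig : Set where
  constructor cellConfig
  field
    state : State
    counterTape oracleTape outputTape workTape : Tape Cell
open CellConfig public

encodeConfig : CellConfig → Config hurwitzMachine
encodeConfig (cellConfig s t₀ t₁ t₂ t₃) =
  conf (stateIndex s) (encodeTape t₀ ∷ᵥ encodeTape t₁ ∷ᵥ encodeTape t₂ ∷ᵥ encodeTape t₃ ∷ᵥ []ᵥ)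

execute : Instruction → Tape Cell → Tape Cell → Tape Cell → Tape Cell → CellConfig
execute (instr s a₀ a₁ a₂ a₃) t₀ t₁ t₂ t₃ = cellConfig s (act a₀ t₀) (act a₁ t₁) (act a₂ t₂) (act a₃ t₃)

cellStep : CellConfig → CellConfig
cellStep (cellConfig s t₀ t₁ t₂ t₃) =
  execute (transition s (Tape.here t₀) (Tape.here t₁) (Tape.here t₂) (Tape.here t₃)) t₀ t₁ t₂ t₃

δ-encode : ∀ s h₀ h₁ h₂ h₃ →
  δ (stateIndex s) (toSym h₀ ∷ᵥ toSym h₁ ∷ᵥ toSym h₂ ∷ᵥ toSym h₃ ∷ᵥ []ᵥ) ≡ encodeInstruction (transition s h₀ h₁ h₂ h₃)
δ-encode s h₀ h₁ h₂ h₃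
  rewrite stateAt-index s | fromSym-toSym h₀ | fromSym-toSym h₁ | fromSym-toSym h₂ | fromSym-toSym h₃ = refl

execute-encode : ∀ i t₀ t₁ t₂ t₃ →
  conf (proj₁ (encodeInstruction i))
       (zipWith writeMove (proj₂ (encodeInstruction i)) (encodeTape t₀ ∷ᵥ encodeTape t₁ ∷ᵥ encodeTape t₂ ∷ᵥ encodeTape t₃ ∷ᵥ []ᵥ))
    ≡ encodeConfig (execute i t₀ t₁ t₂ t₃)
execute-encode (instr s a₀ a₁ a₂ a₃) t₀ t₁ t₂ t₃
  rewrite writeMove-encode a₀ t₀ | writeMove-encode a₁ t₁ | writeMove-encode a₂ t₂ | writeMove-encode a₃ t₃ = refl

Ordinary : State → Set
Ordinary Query = ⊥
Ordinary Halt  = ⊥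
Ordinary _     = ⊤

ordinary≢ : ∀ {s s′} → Ordinary s → ¬ Ordinary s′ → s ≢ s′
ordinary≢ o ¬o refl = ¬o o

module Simulation (f : Word → Word) where

  step-encode : ∀ a → state a ≢ Query → step f hurwitzMachine (encodeConfig a) ≡ (encodeConfig (cellStep a) , 1 , [])
  step-encode (cellConfig s t₀ t₁ t₂ t₃) s≢Query with stateIndex s ≟ stateIndex Query
  ... | yes eq = ⊥-elim (s≢Query (stateIndex-injective eq))
  ... | no _   = trans
    (cong (λ i → conf (proj₁ i) (zipWith writeMove (proj₂ i) ts) , 1 , []) (δ-encode s h₀ h₁ h₂ h₃))
    (cong (_, 1 , []) (execute-encode (transition s h₀ h₁ h₂ h₃) t₀ t₁ t₂ t₃))
    where
    h₀ h₁ h₂ h₃ : Cell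
    h₀ = Tape.here t₀; h₁ = Tape.here t₁; h₂ = Tape.here t₂; h₃ = Tape.here t₃
    ts : Vec (Tape (Sym 64)) 4
    ts = encodeTape t₀ ∷ᵥ encodeTape t₁ ∷ᵥ encodeTape t₂ ∷ᵥ encodeTape t₃ ∷ᵥ []ᵥ

  -- Like Runs, but the final configuration need not be halting.
  data Exec : Config hurwitzMachine → ℕ → List ℕ → Config hurwitzMachine → Set where
    done : ∀ {c} → Exec c 0 [] c
    next : ∀ {c t qs c′} → Config.state c ≢ stateIndex Halt → Exec (proj₁ (step f hurwitzMachine c)) t qs c′ →
           Exec c (proj₁ (proj₂ (step f hurwitzMachine c)) + t) (proj₂ (proj₂ (step f hurwitzMachine c)) ++ qs) c′

  Exec⇒Runs : ∀ {c t qs c′} → Exec c t qs c′ → Config.state c′ ≡ stateIndex Halt → Runs f hurwitzMachine c t qs c′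
  Exec⇒Runs done        halted = stop halted
  Exec⇒Runs (next ¬h e) halted = next ¬h (Exec⇒Runs e halted)

  Exec-trans : ∀ {c t₁ qs₁ c₁ t₂ qs₂ c₂} → Exec c t₁ qs₁ c₁ → Exec c₁ t₂ qs₂ c₂ → Exec c (t₁ + t₂) (qs₁ ++ qs₂) c₂
  Exec-trans done e₂ = e₂
  Exec-trans {c} {t₂ = t₂} {qs₂ = qs₂} {c₂ = c₂} (next {t = t} {qs = qs} ¬h e₁) e₂ =
    subst₂ (λ T Qs → Exec c T Qs c₂)
      (sym (+-assoc (proj₁ (proj₂ (step f hurwitzMachine c))) t t₂))
      (sym (++-assoc (proj₂ (proj₂ (step f hurwitzMachine c))) qs qs₂))
      (next ¬h (Exec-trans e₁ e₂))

  record _↝⟨_∣_⟩_ (a : CellConfig) (t : ℕ) (qs : List ℕ) (b : CellConfig) : Set where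
    constructor ⟨_⟩
    field exec : Exec (encodeConfig a) t qs (encodeConfig b)
  open _↝⟨_∣_⟩_ public

  infixr 4 _⨾_
  _⨾_ : ∀ {a t₁ qs₁ b t₂ qs₂ c} → a ↝⟨ t₁ ∣ qs₁ ⟩ b → b ↝⟨ t₂ ∣ qs₂ ⟩ c → a ↝⟨ t₁ + t₂ ∣ qs₁ ++ qs₂ ⟩ c
  ⟨ e₁ ⟩ ⨾ ⟨ e₂ ⟩ = ⟨ Exec-trans e₁ e₂ ⟩

  stop↝ : ∀ {a} → a ↝⟨ 0 ∣ [] ⟩ a
  stop↝ = ⟨ done ⟩

  -- The hidden argument is ⊤, hence found by eta, for every state but Query and Halt.
  tick : ∀ {a t qs b} {_ : Ordinary (state a)} → cellStep a ↝⟨ t ∣ qs ⟩ b → a ↝⟨ suc t ∣ qs ⟩ b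
  tick {a} {t} {qs} {b} {o} ⟨ e ⟩ =
    ⟨ subst (λ r → Exec (encodeConfig a) (proj₁ (proj₂ r) + t) (proj₂ (proj₂ r) ++ qs) (encodeConfig b)) stepped
        (next (λ eq → ordinary≢ {s′ = Halt} o (λ ()) (stateIndex-injective eq)) (subst (λ r → Exec (proj₁ r) t qs (encodeConfig b)) (sym stepped) e)) ⟩
    where stepped = step-encode a (ordinary≢ {s′ = Query} o λ ())

  from≡ : ∀ {a a′ t qs b} → a ≡ a′ → a′ ↝⟨ t ∣ qs ⟩ b → a ↝⟨ t ∣ qs ⟩ b
  from≡ refl e = e

  to≡ : ∀ {a t qs b b′} → b ≡ b′ → a ↝⟨ t ∣ qs ⟩ b → a ↝⟨ t ∣ qs ⟩ b′
  to≡ refl e = e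

  retime : ∀ {a t t′ qs b} → t ≡ t′ → a ↝⟨ t ∣ qs ⟩ b → a ↝⟨ t′ ∣ qs ⟩ b
  retime refl e = e

atRight : List Cell → List Cell → Tape Cell
atRight l []      = tape l □ []
atRight l (x ∷ r) = tape l x r

atLeft : List Cell → List Cell → Tape Cell
atLeft []      r = tape [] □ r
atLeft (x ∷ l) r = tape l x r

moveR-atRight : ∀ l h r → moveCell R (tape l h r) ≡ atRight (h ∷ l) r
moveR-atRight l h []      = refl
moveR-atRight l h (x ∷ r) = refl

moveL-atLeft : ∀ l h r → moveCell L (tape l h r) ≡ atLeft l (h ∷ r)
moveL-atLeft []      h r = refl
moveL-atLeft (x ∷ l) h r = refl

bits-replicate-++-∷ : ∀ j b r → map bit (replicate j b) ++ bit b ∷ r ≡ bit b ∷ map bit (replicate j b) ++ r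
bits-replicate-++-∷ j b r rewrite map-replicate bit j b = replicate-++-∷ j (bit b) r

takeBits-bits : ∀ (w : Word) r → takeBits {64} (map bitSym w ++ zero ∷ r) ≡ w
takeBits-bits []          r = refl
takeBits-bits (false ∷ w) r = cong (false ∷_) (takeBits-bits w r)
takeBits-bits (true ∷ w)  r = cong (true ∷_) (takeBits-bits w r)

map-toSym-bit : ∀ (w : Word) → map toSym (map bit w) ≡ map bitSym w
map-toSym-bit []      = refl
map-toSym-bit (b ∷ w) = cong (bitSym b ∷_) (map-toSym-bit w)

wordOn-written : ∀ w → wordOn (encodeTape (atRight (reverse (map bit w)) [])) ≡ w
wordOn-written w = trans (cong (λ l → takeBits (dropBlanks (l ++ zero ∷ []))) unreversed) (readBack w)
  where
  unreversed : reverse (map toSym (reverse (map bit w))) ≡ map bitSym w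
  unreversed = trans (sym (reverse-map toSym (reverse (map bit w)))) (trans (cong (map toSym) (reverse-involutive (map bit w))) (map-toSym-bit w))
  readBack : ∀ w → takeBits (dropBlanks {64} (map bitSym w ++ zero ∷ [])) ≡ w
  readBack []          = refl
  readBack (false ∷ w) = takeBits-bits (false ∷ w) []
  readBack (true ∷ w)  = takeBits-bits (true ∷ w) []

tapeOf-encode : ∀ w → tapeOf {64} w ≡ encodeTape (atRight [] (map bit w))
tapeOf-encode []      = refl
tapeOf-encode (b ∷ w) = cong (tape [] (bitSym b)) (sym (map-toSym-bit w))

-- The cells left of the columns on the work tape: none in the first round, one blank afterwards.
data Margin : List Cell → Set where
  none : Margin []
  one  : Margin (□ ∷ [])

module PhaseRuns (f : Word → Word) where
  open Simulation f

  scanInput-run : ∀ us l t₁ t₂ t₃ →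
    cellConfig ScanInput (atRight l (map bit us)) t₁ t₂ t₃ ↝⟨ suc (length us) ∣ [] ⟩
    cellConfig PutFirstColumn (atLeft (map bit us ʳ++ l) (□ ∷ [])) t₁ t₂ t₃
  scanInput-run []       l t₁ t₂ t₃ = tick (from≡ (cong (λ T → cellConfig PutFirstColumn T t₁ t₂ t₃) (moveL-atLeft l □ [])) stop↝)
  scanInput-run (u ∷ us) l t₁ t₂ t₃ =
    tick (from≡ (cong (λ T → cellConfig ScanInput T t₁ t₂ t₃) (moveR-atRight l (bit u) (map bit us))) (scanInput-run us (bit u ∷ l) t₁ t₂ t₃))

  putColumns-run : ∀ t₀ t₁ t₂ →
    cellConfig PutFirstColumn t₀ t₁ t₂ (tape [] □ []) ↝⟨ 2 ∣ [] ⟩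
    cellConfig Decrement t₀ t₁ t₂ (atRight [] (col rootColumn ∷ col zeroColumn ∷ []))
  putColumns-run t₀ t₁ t₂ = tick (tick stop↝)

  decrement-run : ∀ j rest r t₁ t₂ t₃ →
    cellConfig Decrement (atLeft (map bit (replicate j false ++ true ∷ rest)) r) t₁ t₂ t₃ ↝⟨ suc j ∣ [] ⟩
    cellConfig SeekCounterEnd (atRight (bit false ∷ map bit rest) (map bit (replicate j true) ++ r)) t₁ t₂ t₃
  decrement-run zero    rest r t₁ t₂ t₃ =
    tick (from≡ (cong (λ T → cellConfig SeekCounterEnd T t₁ t₂ t₃) (moveR-atRight (map bit rest) (bit false) r)) stop↝)
  decrement-run (suc j) rest r t₁ t₂ t₃ =
    tick (from≡ (cong (λ T → cellConfig Decrement T t₁ t₂ t₃) (moveL-atLeft (map bit (replicate j false ++ true ∷ rest)) (bit true) r))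
      (to≡ (cong (λ R → cellConfig SeekCounterEnd (atRight (bit false ∷ map bit rest) R) t₁ t₂ t₃) (bits-replicate-++-∷ j true r))
        (decrement-run j rest (bit true ∷ r) t₁ t₂ t₃)))

  decrement-exhausted : ∀ j r t₁ t₂ t₃ →
    cellConfig Decrement (atLeft (map bit (replicate j false)) r) t₁ t₂ t₃ ↝⟨ suc j ∣ [] ⟩
    cellConfig Halt (tape [] □ (map bit (replicate j true) ++ r)) t₁ t₂ t₃
  decrement-exhausted zero    r t₁ t₂ t₃ = tick stop↝
  decrement-exhausted (suc j) r t₁ t₂ t₃ =
    tick (from≡ (cong (λ T → cellConfig Decrement T t₁ t₂ t₃) (moveL-atLeft (map bit (replicate j false)) (bit true) r))
      (to≡ (cong (λ R → cellConfig Halt (tape [] □ R) t₁ t₂ t₃) (bits-replicate-++-∷ j true r))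
        (decrement-exhausted j (bit true ∷ r) t₁ t₂ t₃)))

  seekCounterEnd-run : ∀ bs c l t₁ t₂ t₃ →
    cellConfig SeekCounterEnd (atRight (c ∷ l) (map bit bs ++ □ ∷ [])) t₁ t₂ t₃ ↝⟨ suc (length bs) ∣ [] ⟩
    cellConfig (Add false false) (atLeft (map bit bs ʳ++ c ∷ l) (□ ∷ [])) t₁ t₂ t₃
  seekCounterEnd-run []       c l t₁ t₂ t₃ = tick stop↝
  seekCounterEnd-run (b ∷ bs) c l t₁ t₂ t₃ =
    tick (from≡ (cong (λ T → cellConfig SeekCounterEnd T t₁ t₂ t₃) (moveR-atRight (c ∷ l) (bit b) (map bit bs ++ □ ∷ [])))
      (seekCounterEnd-run bs (bit b) (c ∷ l) t₁ t₂ t₃))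

  add-run : ∀ c₁ c₂ xs l t₀ t₁ t₂ →
    cellConfig (Add c₁ c₂) t₀ t₁ t₂ (atRight l (map col xs)) ↝⟨ suc (length xs) ∣ [] ⟩
    cellConfig SkipZeroColumns t₀ t₁ t₂ (atLeft (map col (addColumns c₁ c₂ xs) ʳ++ l) (□ ∷ []))
  add-run c₁ c₂ []       l t₀ t₁ t₂ = tick (from≡ (cong (cellConfig SkipZeroColumns t₀ t₁ t₂) (moveL-atLeft l □ [])) stop↝)
  add-run c₁ c₂ (x ∷ xs) l t₀ t₁ t₂ =
    tick (from≡ (cong (cellConfig _ t₀ t₁ t₂) (moveR-atRight l (col (proj₁ (addColumn c₁ c₂ x))) (map col xs)))
      (add-run _ _ xs _ t₀ t₁ t₂))

  skipZeroColumns-run : ∀ zs l r t₀ t₁ t₂ → All (λ z → mDen z ≡ false) zs →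
    cellConfig SkipZeroColumns t₀ t₁ t₂ (atLeft (map col zs ++ l) r) ↝⟨ length zs ∣ [] ⟩
    cellConfig SkipZeroColumns t₀ t₁ t₂ (atLeft l (map col zs ʳ++ r))
  skipZeroColumns-run []                              l r t₀ t₁ t₂ []         = stop↝
  skipZeroColumns-run (column a b c d p .false ∷ zs) l r t₀ t₁ t₂ (refl ∷ zs0) =
    tick (from≡ (cong (cellConfig SkipZeroColumns t₀ t₁ t₂) (moveL-atLeft (map col zs ++ l) (col (column a b c d p false)) r))
      (skipZeroColumns-run zs l _ t₀ t₁ t₂ zs0))

  emit-run : ∀ ys l r W t₀ t₂ →
    cellConfig EmitNum t₀ (atRight W []) t₂ (atLeft (map col ys ++ l) r) ↝⟨ length (emitted ys) ∣ [] ⟩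
    cellConfig EmitNum t₀ (atRight (map bit (emitted ys) ʳ++ W) []) t₂ (atLeft l (map col ys ʳ++ r))
  emit-run []       l r W t₀ t₂ = stop↝
  emit-run (y ∷ ys) l r W t₀ t₂ =
    tick (tick (from≡ (cong (cellConfig EmitNum t₀ _ t₂) (moveL-atLeft (map col ys ++ l) (col y) r))
      (emit-run ys l _ _ t₀ t₂)))

  emit-end : ∀ {l} r t₁ t₀ t₂ → Margin l →
    cellConfig EmitNum t₀ t₁ t₂ (atLeft l r) ↝⟨ 1 ∣ [] ⟩ cellConfig Query t₀ t₁ t₂ (atRight (□ ∷ []) r)
  emit-end r t₁ t₀ t₂ none = tick (from≡ (cong (cellConfig Query t₀ t₁ t₂) (moveR-atRight [] □ r)) stop↝)
  emit-end r t₁ t₀ t₂ one  = tick (from≡ (cong (cellConfig Query t₀ t₁ t₂) (moveR-atRight [] □ r)) stop↝)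

  emitQuery-run : ∀ {l} zs x rest r h t₀ t₂ → All (λ z → mDen z ≡ false) zs → mDen x ≡ true → Margin l →
    cellConfig SkipZeroColumns t₀ (tape [] h []) t₂ (atLeft (map col zs ++ col x ∷ map col rest ++ l) r)
      ↝⟨ length zs + (length (emitted (x ∷ rest)) + 1) ∣ [] ⟩
    cellConfig Query t₀ (atRight (reverse (map bit (emitted (x ∷ rest)))) []) t₂
      (atRight (□ ∷ []) (map col rest ʳ++ col x ∷ map col zs ʳ++ r))
  emitQuery-run {l} zs (column a b c d p .true) rest r h t₀ t₂ zs0 refl margin =
    skipZeroColumns-run zs (col x ∷ map col rest ++ l) r t₀ (tape [] h []) t₂ zs0
    ⨾ tick (tick (from≡ (cong (cellConfig EmitNum t₀ _ t₂) (moveL-atLeft (map col rest ++ l) (col x) (map col zs ʳ++ r)))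
        (emit-run rest l _ _ t₀ t₂ ⨾ emit-end _ _ t₀ t₂ margin)))
    where x = column a b c d p true

  query-step : ∀ t₀ w t₂ t₃ d → f w ≡ d ∷ [] →
    cellConfig Query t₀ (atRight (reverse (map bit w)) []) t₂ t₃ ↝⟨ 1 ∣ length w ∷ [] ⟩
    cellConfig Answer t₀ (tape [] (bit d) []) t₂ t₃
  query-step t₀ w t₂ t₃ d answer =
    ⟨ subst₂ (λ a q → Exec (encodeConfig (cellConfig Query t₀ t₁ t₂ t₃)) (length a + 0) (length q ∷ [])
                        (conf (stateIndex Answer) (encodeTape t₀ ∷ᵥ tapeOf a ∷ᵥ encodeTape t₂ ∷ᵥ encodeTape t₃ ∷ᵥ []ᵥ)))
        (trans (cong f (wordOn-written w)) answer) (wordOn-written w) (next (λ ()) done) ⟩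
    where t₁ = atRight (reverse (map bit w)) []

  answer-step : ∀ d W t₀ t₃ →
    cellConfig Answer t₀ (tape [] (bit d) []) (atRight W []) t₃ ↝⟨ 1 ∣ [] ⟩
    cellConfig (Replace (not d)) t₀ (tape [] (bit d) []) (atRight (bit (not d) ∷ W) []) t₃
  answer-step d W t₀ t₃ = tick stop↝

  replace-run : ∀ β xs l r t₀ t₁ t₂ →
    cellConfig (Replace β) t₀ t₁ t₂ (atRight l (map col xs ++ r)) ↝⟨ length xs ∣ [] ⟩
    cellConfig (Replace β) t₀ t₁ t₂ (atRight (map col (map (replace β) xs) ʳ++ l) r)
  replace-run β []       l r t₀ t₁ t₂ = stop↝
  replace-run β (x ∷ xs) l r t₀ t₁ t₂ =
    tick (from≡ (cong (cellConfig (Replace β) t₀ t₁ t₂) (moveR-atRight l (col (replace β x)) (map col xs ++ r)))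
      (replace-run β xs _ r t₀ t₁ t₂))

  replace-end : ∀ β l t₀ t₁ t₂ →
    cellConfig (Replace β) t₀ t₁ t₂ (atRight l (□ ∷ [])) ↝⟨ 1 ∣ [] ⟩ cellConfig Rewind t₀ t₁ t₂ (atLeft l (col zeroColumn ∷ []))
  replace-end β l t₀ t₁ t₂ = tick (from≡ (cong (cellConfig Rewind t₀ t₁ t₂) (moveL-atLeft l (col zeroColumn) [])) stop↝)

  rewind-run : ∀ xs l r t₀ t₁ t₂ →
    cellConfig Rewind t₀ t₁ t₂ (atLeft (map col xs ++ l) r) ↝⟨ length xs ∣ [] ⟩
    cellConfig Rewind t₀ t₁ t₂ (atLeft l (map col xs ʳ++ r))
  rewind-run []       l r t₀ t₁ t₂ = stop↝
  rewind-run (x ∷ xs) l r t₀ t₁ t₂ =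
    tick (from≡ (cong (cellConfig Rewind t₀ t₁ t₂) (moveL-atLeft (map col xs ++ l) (col x) r))
      (rewind-run xs l _ t₀ t₁ t₂))

  rewind-end : ∀ r t₀ t₁ t₂ →
    cellConfig Rewind t₀ t₁ t₂ (atLeft (□ ∷ []) r) ↝⟨ 1 ∣ [] ⟩ cellConfig Decrement t₀ t₁ t₂ (atRight (□ ∷ []) r)
  rewind-end r t₀ t₁ t₂ = tick (from≡ (cong (cellConfig Decrement t₀ t₁ t₂) (moveR-atRight [] □ r)) stop↝)

track : (Column → Bool) → List Column → ℕ
track g xs = fromBits (map g xs)

Represents : FareyPair → List Column → ℕ → Set
Represents p xs l =
  (track lNum xs ≡ leftNum p) × (track lDen xs ≡ leftDen p) × (track rNum xs ≡ rightNum p) × (track rDen xs ≡ rightDen p) ×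
  (length xs ≡ l)

represents-root : Represents (farey []) (rootColumn ∷ zeroColumn ∷ []) 2
represents-root = refl , refl , refl , refl , refl

map-addColumns : ∀ (g : Column → Bool) → (∀ c₁ c₂ x → g (proj₁ (addColumn c₁ c₂ x)) ≡ g x) →
  ∀ c₁ c₂ xs → map g (addColumns c₁ c₂ xs) ≡ map g xs
map-addColumns g keeps c₁ c₂ []       = refl
map-addColumns g keeps c₁ c₂ (x ∷ xs) = cong₂ _∷_ (keeps c₁ c₂ x) (map-addColumns g keeps _ _ xs)

length-addColumns : ∀ c₁ c₂ xs → length (addColumns c₁ c₂ xs) ≡ length xs
length-addColumns c₁ c₂ []       = refl
length-addColumns c₁ c₂ (x ∷ xs) = cong suc (length-addColumns _ _ xs)

mNum-addColumns : ∀ c₁ c₂ xs → map mNum (addColumns c₁ c₂ xs) ≡ rippleAdd c₁ (map lNum xs) (map rNum xs)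
mNum-addColumns c₁ c₂ []       = refl
mNum-addColumns c₁ c₂ (x ∷ xs) = cong (_ ∷_) (mNum-addColumns _ _ xs)

mDen-addColumns : ∀ c₁ c₂ xs → map mDen (addColumns c₁ c₂ xs) ≡ rippleAdd c₂ (map lDen xs) (map rDen xs)
mDen-addColumns c₁ c₂ []       = refl
mDen-addColumns c₁ c₂ (x ∷ xs) = cong (_ ∷_) (mDen-addColumns _ _ xs)

withMediant : List Column → List Column
withMediant = addColumns false false

track-rippleAdd : ∀ (left right : Column → Bool) xs → track left xs + track right xs < 2 ^ length xs →
  fromBits (rippleAdd false (map left xs) (map right xs)) ≡ track left xs + track right xs
track-rippleAdd left right xs fits =
  fromBits-rippleAdd false (map left xs) (map right xs) (trans (length-map left xs) (sym (length-map right xs)))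
    (subst (λ l → track left xs + track right xs < 2 ^ l) (sym (length-map left xs)) fits)

mediant-withMediant : ∀ {p xs k} → Represents p xs (suc (suc k)) → FareyBounded k p →
  (track mNum (withMediant xs) ≡ mediantNum p) × (track mDen (withMediant xs) ≡ mediantDen p)
mediant-withMediant {p} {xs} {k} (ln , ld , rn , rd , len) (ld< , rd< , ln≤ , rn≤) =
  trans (cong fromBits (mNum-addColumns false false xs)) (trans (track-rippleAdd lNum rNum xs numFits) (cong₂ _+_ ln rn)) ,
  trans (cong fromBits (mDen-addColumns false false xs)) (trans (track-rippleAdd lDen rDen xs denFits) (cong₂ _+_ ld rd))
  where
  fits : ∀ {x y} → x < 2 ^ suc k → y < 2 ^ suc k → x + y < 2 ^ length xs
  fits {x} {y} x< y< = subst (λ l → x + y < 2 ^ l) (sym len) (sum<2^suc {suc k} x< y<)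
  numFits : track lNum xs + track rNum xs < 2 ^ length xs
  numFits = subst₂ (λ a c → a + c < 2 ^ length xs) (sym ln) (sym rn) (fits (≤-<-trans ln≤ ld<) (≤-<-trans rn≤ rd<))
  denFits : track lDen xs + track rDen xs < 2 ^ length xs
  denFits = subst₂ (λ b d → b + d < 2 ^ length xs) (sym ld) (sym rd) (fits ld< rd<)

track-replace : ∀ (g h : Column → Bool) β ys → (∀ x → g (replace β x) ≡ h x) → g zeroColumn ≡ false →
  track g (map (replace β) ys ++ zeroColumn ∷ []) ≡ track h ys
track-replace g h β ys gh gz = begin
  fromBits (map g (map (replace β) ys ++ zeroColumn ∷ []))   ≡⟨ cong fromBits (map-++ g (map (replace β) ys) _) ⟩
  fromBits (map g (map (replace β) ys) ++ g zeroColumn ∷ [])  ≡⟨ fromBits-++-highZero (map g (map (replace β) ys)) (cong (λ b → bitValue b + 0) gz) ⟩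
  fromBits (map g (map (replace β) ys))                       ≡⟨ cong fromBits (trans (sym (map-∘ ys)) (map-cong gh ys)) ⟩
  fromBits (map h ys)                                         ∎
  where open ≡-Reasoning

track-withMediant : ∀ (g : Column → Bool) → (∀ c₁ c₂ x → g (proj₁ (addColumn c₁ c₂ x)) ≡ g x) → ∀ xs →
  track g (withMediant xs) ≡ track g xs
track-withMediant g keeps xs = cong fromBits (map-addColumns g keeps false false xs)

length-next : ∀ β xs {l} → length xs ≡ l → length (map (replace β) (withMediant xs) ++ zeroColumn ∷ []) ≡ suc l
length-next β xs len =
  trans (length-++ (map (replace β) (withMediant xs)))
    (trans (+-comm _ 1) (cong suc (trans (length-map (replace β) (withMediant xs)) (trans (length-addColumns false false xs) len))))

represents-next : ∀ {p xs l} β → Represents p xs l →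
  track mNum (withMediant xs) ≡ mediantNum p → track mDen (withMediant xs) ≡ mediantDen p →
  Represents (fareyFrom p (β ∷ [])) (map (replace β) (withMediant xs) ++ zeroColumn ∷ []) (suc l)
represents-next {p = a , b , c , d} {xs} true (ln , ld , rn , rd , len) mn md =
  trans (track-replace lNum mNum true (withMediant xs) (λ _ → refl) refl) mn ,
  trans (track-replace lDen mDen true (withMediant xs) (λ _ → refl) refl) md ,
  trans (track-replace rNum rNum true (withMediant xs) (λ _ → refl) refl) (trans (track-withMediant rNum (λ _ _ _ → refl) xs) rn) ,
  trans (track-replace rDen rDen true (withMediant xs) (λ _ → refl) refl) (trans (track-withMediant rDen (λ _ _ _ → refl) xs) rd) ,
  length-next true xs len
represents-next {p = a , b , c , d} {xs} false (ln , ld , rn , rd , len) mn md =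
  trans (track-replace lNum lNum false (withMediant xs) (λ _ → refl) refl) (trans (track-withMediant lNum (λ _ _ _ → refl) xs) ln) ,
  trans (track-replace lDen lDen false (withMediant xs) (λ _ → refl) refl) (trans (track-withMediant lDen (λ _ _ _ → refl) xs) ld) ,
  trans (track-replace rNum mNum false (withMediant xs) (λ _ → refl) refl) mn ,
  trans (track-replace rDen mDen false (withMediant xs) (λ _ → refl) refl) md ,
  length-next false xs len

topDenColumn : ∀ cs → All (λ z → mDen z ≡ false) cs ⊎
  Σ (List Column) λ zs → Σ Column λ x → Σ (List Column) λ rest →
    (cs ≡ zs ++ x ∷ rest) × All (λ z → mDen z ≡ false) zs × (mDen x ≡ true)
topDenColumn []       = inj₁ []
topDenColumn (y ∷ cs) with mDen y in y≡
... | true  = inj₂ ([] , y , cs , refl , [] , y≡)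
... | false with topDenColumn cs
...   | inj₁ all0                          = inj₁ (y≡ ∷ all0)
...   | inj₂ (zs , x , rest , refl , zs0 , x1) = inj₂ (y ∷ zs , x , rest , refl , y≡ ∷ zs0 , x1)

map-reverse-split : ∀ (g : Column → Bool) ys zs cs → reverse ys ≡ zs ++ cs → map g ys ≡ reverse (map g cs) ++ reverse (map g zs)
map-reverse-split g ys zs cs split = begin
  map g ys                                 ≡⟨ cong (map g) (reverse-involutive ys) ⟨
  map g (reverse (reverse ys))             ≡⟨ cong (λ l → map g (reverse l)) split ⟩
  map g (reverse (zs ++ cs))               ≡⟨ cong (map g) (reverse-++ zs cs) ⟩
  map g (reverse cs ++ reverse zs)         ≡⟨ map-++ g (reverse cs) (reverse zs) ⟩
  map g (reverse cs) ++ map g (reverse zs) ≡⟨ cong₂ _++_ (reverse-map g cs) (reverse-map g zs) ⟩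
  reverse (map g cs) ++ reverse (map g zs) ∎
  where open ≡-Reasoning

emitted-encQ : ∀ ys zs x rest → reverse ys ≡ zs ++ x ∷ rest → All (λ z → mDen z ≡ false) zs → mDen x ≡ true →
  track mNum ys ≤ track mDen ys → emitted (x ∷ rest) ≡ encQ (track mNum ys) (track mDen ys)
emitted-encQ ys zs x rest split zs0 x1 num≤den =
  sym (trans (cong₂ encQ numLow denLow) (encQ-fromBits (map mNum cs) (map mDen cs) sameLength msb))
  where
  cs : List Column
  cs = x ∷ rest
  sameLength : length (map mNum cs) ≡ length (map mDen cs)
  sameLength = trans (length-map mNum cs) (sym (length-map mDen cs))
  denLow : track mDen ys ≡ fromBits (reverse (map mDen cs))
  denLow = trans (cong fromBits (map-reverse-split mDen ys zs cs split))
    (fromBits-++-highZero (reverse (map mDen cs)) (fromBits-allFalse (All-reverse (map⁺ zs0))))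
  numSmall : fromBits (reverse (map mNum cs) ++ reverse (map mNum zs)) < 2 ^ length (reverse (map mNum cs))
  numSmall = begin-strict
    fromBits (reverse (map mNum cs) ++ reverse (map mNum zs)) ≡⟨ cong fromBits (map-reverse-split mNum ys zs cs split) ⟨
    track mNum ys                                            ≤⟨ num≤den ⟩
    track mDen ys                                            ≡⟨ denLow ⟩
    fromBits (reverse (map mDen cs))                         <⟨ fromBits<2^length (reverse (map mDen cs)) ⟩
    2 ^ length (reverse (map mDen cs))                       ≡⟨ cong (2 ^_) (trans (length-reverse (map mDen cs)) (trans (sym sameLength) (sym (length-reverse (map mNum cs))))) ⟩
    2 ^ length (reverse (map mNum cs))                       ∎
    where open ≤-Reasoning
  numLow : track mNum ys ≡ fromBits (reverse (map mNum cs))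
  numLow = trans (cong fromBits (map-reverse-split mNum ys zs cs split)) (fromBits-++-small (reverse (map mNum cs)) (reverse (map mNum zs)) numSmall)
  msb : MsbSet (reverse (map mDen cs))
  msb rewrite x1 = msbSet-reverse (map mDen rest)

length-emitted : ∀ cs → length (emitted cs) ≡ length cs + length cs
length-emitted []       = refl
length-emitted (c ∷ cs) = cong suc (trans (cong suc (length-emitted cs)) (sym (+-suc (length cs) (length cs))))

map-ʳ++-split : ∀ {A : Set} {g : Column → A} ys zs cs l → reverse ys ≡ zs ++ cs → map g ys ʳ++ l ≡ map g zs ++ map g cs ++ l
map-ʳ++-split {g = g} ys zs cs l split = begin
  map g ys ʳ++ l                      ≡⟨ ʳ++-defn (map g ys) ⟩
  reverse (map g ys) ++ l             ≡⟨ cong (_++ l) (reverse-map g ys) ⟨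
  map g (reverse ys) ++ l             ≡⟨ cong (λ r → map g r ++ l) split ⟩
  map g (zs ++ cs) ++ l               ≡⟨ cong (_++ l) (map-++ g zs cs) ⟩
  (map g zs ++ map g cs) ++ l         ≡⟨ ++-assoc (map g zs) (map g cs) l ⟩
  map g zs ++ map g cs ++ l           ∎
  where open ≡-Reasoning

map-ʳ++-unsplit : ∀ {A : Set} {g : Column → A} ys zs cs r → reverse ys ≡ zs ++ cs → map g cs ʳ++ map g zs ʳ++ r ≡ map g ys ++ r
map-ʳ++-unsplit {g = g} ys zs cs r split = begin
  map g cs ʳ++ map g zs ʳ++ r         ≡⟨ ++-ʳ++ (map g zs) ⟨
  (map g zs ++ map g cs) ʳ++ r        ≡⟨ cong (_ʳ++ r) (map-++ g zs cs) ⟨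
  map g (zs ++ cs) ʳ++ r              ≡⟨ cong (λ l → map g l ʳ++ r) split ⟨
  map g (reverse ys) ʳ++ r            ≡⟨ ʳ++-defn (map g (reverse ys)) ⟩
  reverse (map g (reverse ys)) ++ r   ≡⟨ cong (_++ r) (reverse-map g (reverse ys)) ⟨
  map g (reverse (reverse ys)) ++ r   ≡⟨ cong (λ l → map g l ++ r) (reverse-involutive ys) ⟩
  map g ys ++ r                       ∎
  where open ≡-Reasoning

round-time≤ : ∀ {n j w w′ z e r} → suc j ≤ n → w ≤ suc n → w′ ≡ w → z + suc r ≡ w → e ≡ suc r + suc r →
  (suc j + suc j) + (suc w + ((z + (e + 1) + (1 + 1)) + (w′ + (1 + (w′ + 1))))) ≤ 13 * suc n
round-time≤ {n} {j} {z = z} {r = r} j<n w≤ refl refl refl = begin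
  (suc j + suc j) + (suc w + ((z + ((suc r + suc r) + 1) + (1 + 1)) + (w + (1 + (w + 1)))))
    ≡⟨ solve 3 (λ j z r →
         ((con 1 :+ j) :+ (con 1 :+ j)) :+ ((con 1 :+ (z :+ (con 1 :+ r))) :+ ((z :+ (((con 1 :+ r) :+ (con 1 :+ r)) :+ con 1) :+ (con 1 :+ con 1)) :+ ((z :+ (con 1 :+ r)) :+ (con 1 :+ ((z :+ (con 1 :+ r)) :+ con 1)))))
         := con 2 :* j :+ con 4 :* z :+ con 5 :* r :+ con 13) refl j z r ⟩
  2 * j + 4 * z + 5 * r + 13
    ≤⟨ +-monoˡ-≤ 13 (+-mono-≤ (+-mono-≤ (*-monoʳ-≤ 2 (<⇒≤ j<n)) (*-monoˡ-≤ z (n≤1+n 4))) ≤-refl) ⟩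
  2 * n + 5 * z + 5 * r + 13
    ≡⟨ cong (_+ 13) (+-assoc (2 * n) (5 * z) (5 * r)) ⟩
  2 * n + (5 * z + 5 * r) + 13
    ≡⟨ cong (λ m → 2 * n + m + 13) (*-distribˡ-+ 5 z r) ⟨
  2 * n + 5 * (z + r) + 13
    ≤⟨ +-monoˡ-≤ 13 (+-monoʳ-≤ (2 * n) (*-monoʳ-≤ 5 (≤-pred (subst (_≤ suc n) (+-suc z r) w≤)))) ⟩
  2 * n + 5 * n + 13
    ≤⟨ solve-≤ n ⟩
  13 * suc n ∎
  where
  open ≤-Reasoning
  w : ℕ
  w = z + suc r
  solve-≤ : ∀ n → 2 * n + 5 * n + 13 ≤ 13 * suc n
  solve-≤ n = ≤-trans (≤-reflexive (solve 1 (λ n → con 2 :* n :+ con 5 :* n :+ con 13 := con 7 :* n :+ con 13) refl n))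
    (≤-trans (+-monoˡ-≤ 13 (*-monoˡ-≤ n (m≤m+n 7 6))) (≤-reflexive (solve 1 (λ n → con 13 :* n :+ con 13 := con 13 :* (con 1 :+ n)) refl n)))

query-size≤ : ∀ {n k e r w} → suc k ≤ n → suc r ≤ w → w ≤ suc n → e ≡ suc r + suc r → e ≤ 4 * n
query-size≤ {suc n} {r = r} _ r<w w≤ refl = begin
  suc r + suc r          ≤⟨ +-mono-≤ r≤ r≤ ⟩
  suc (suc n) + suc (suc n) ≡⟨ solve 1 (λ n → (con 2 :+ n) :+ (con 2 :+ n) := con 4 :+ con 2 :* n) refl n ⟩
  4 + 2 * n              ≤⟨ +-monoʳ-≤ 4 (*-monoˡ-≤ n (m≤m+n 2 2)) ⟩
  4 + 4 * n              ≡⟨ solve 1 (λ n → con 4 :+ con 4 :* n := con 4 :* (con 1 :+ n)) refl n ⟩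
  4 * suc n              ∎
  where
  open ≤-Reasoning
  r≤ : suc r ≤ suc (suc n)
  r≤ = ≤-trans r<w w≤

total-time≤ : ∀ {n l t} → l ≤ n → t ≤ suc n * (13 * suc n) → suc l + 2 + t ≤ 16 * suc n ^ 2
total-time≤ {n} {l} {t} l≤n t≤ = begin
  suc l + 2 + t                        ≤⟨ +-mono-≤ (+-monoˡ-≤ 2 (s≤s l≤n)) t≤ ⟩
  suc n + 2 + suc n * (13 * suc n)     ≤⟨ +-monoˡ-≤ (suc n * (13 * suc n)) (+-mono-≤ (m≤m*n (suc n) (suc n)) (*-monoʳ-≤ 2 (m≤m*n 1 (suc n * suc n)))) ⟩
  suc n * suc n + 2 * (1 * (suc n * suc n)) + suc n * (13 * suc n)
    ≡⟨ solve 1 (λ m → m :* m :+ con 2 :* (con 1 :* (m :* m)) :+ m :* (con 13 :* m) := con 16 :* (m :* (m :* con 1))) refl (suc n) ⟩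
  16 * suc n ^ 2                       ∎
  where open ≤-Reasoning

module Rounds (D : ℚ → Bool) (f : Word → Word) (oracle : ∀ p q → f (encQ p (suc q)) ≡ D (+ p ÷ suc q) ∷ []) where
  open Simulation f
  open PhaseRuns f

  pairAt : ℕ → FareyPair
  pairAt k = farey (hurwitz D k)

  answerAt : ℕ → Bool
  answerAt k = D (+ mediantNum (pairAt k) ÷ mediantDen (pairAt k))

  outputTapeAt : ℕ → Tape Cell
  outputTapeAt k = atRight (reverse (map bit (hurwitz D k))) []

  outputTape-next : ∀ k → atRight (bit (not (answerAt k)) ∷ reverse (map bit (hurwitz D k))) [] ≡ outputTapeAt (suc k)
  outputTape-next k = cong (λ l → atRight l [])
    (sym (trans (cong reverse (map-++ bit (hurwitz D k) _)) (reverse-++ (map bit (hurwitz D k)) _)))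

  -- Query tape head h: a blank before the first query, the previous answer afterwards.
  roundStart : List Bool → Cell → ℕ → List Column → List Cell → CellConfig
  roundStart bs h k xs l = cellConfig Decrement (atLeft (map bit bs) (□ ∷ [])) (tape [] h []) (outputTapeAt k) (atRight l (map col xs))

  decrement-phase : ∀ j rest h k xs l →
    roundStart (replicate j false ++ true ∷ rest) h k xs l ↝⟨ suc j + suc j ∣ [] ⟩
    cellConfig (Add false false) (atLeft (map bit (replicate j true ++ false ∷ rest)) (□ ∷ [])) (tape [] h []) (outputTapeAt k) (atRight l (map col xs))
  decrement-phase j rest h k xs l =
    decrement-run j rest (□ ∷ []) q o w
    ⨾ retime (cong suc (length-replicate j))
        (to≡ (cong (λ bs → cellConfig (Add false false) (atLeft bs (□ ∷ [])) q o w) decremented)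
          (seekCounterEnd-run (replicate j true) (bit false) (map bit rest) q o w))
    where
    q : Tape Cell
    q = tape [] h []
    o : Tape Cell
    o = outputTapeAt k
    w : Tape Cell
    w = atRight l (map col xs)
    decremented : map bit (replicate j true) ʳ++ bit false ∷ map bit rest ≡ map bit (replicate j true ++ false ∷ rest)
    decremented = begin
      map bit (replicate j true) ʳ++ bit false ∷ map bit rest    ≡⟨ cong (_ʳ++ _) (map-replicate bit j true) ⟩
      replicate j (bit true) ʳ++ bit false ∷ map bit rest        ≡⟨ replicate-ʳ++ j (bit true) _ ⟩
      replicate j (bit true) ++ bit false ∷ map bit rest         ≡⟨ cong (_++ _) (map-replicate bit j true) ⟨
      map bit (replicate j true) ++ map bit (false ∷ rest)       ≡⟨ map-++ bit (replicate j true) (false ∷ rest) ⟨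
      map bit (replicate j true ++ false ∷ rest)                 ∎
      where open ≡-Reasoning

  query-phase : ∀ k ys zs x rest {l} cnt h → reverse ys ≡ zs ++ x ∷ rest → All (λ z → mDen z ≡ false) zs → mDen x ≡ true → Margin l →
    emitted (x ∷ rest) ≡ encQ (mediantNum (pairAt k)) (mediantDen (pairAt k)) →
    cellConfig SkipZeroColumns cnt (tape [] h []) (outputTapeAt k) (atLeft (map col ys ʳ++ l) (□ ∷ []))
      ↝⟨ length zs + (length (emitted (x ∷ rest)) + 1) + (1 + 1) ∣ length (emitted (x ∷ rest)) ∷ [] ⟩
    cellConfig (Replace (not (answerAt k))) cnt (tape [] (bit (answerAt k)) []) (outputTapeAt (suc k)) (atRight (□ ∷ []) (map col ys ++ □ ∷ []))
  query-phase k ys zs x rest {l} cnt h split zs0 x1 margin asked =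
    from≡ (cong (λ L → cellConfig SkipZeroColumns cnt (tape [] h []) (outputTapeAt k) (atLeft L (□ ∷ []))) (map-ʳ++-split ys zs (x ∷ rest) l split))
      (to≡ (cong (λ R → cellConfig Query cnt written (outputTapeAt k) (atRight (□ ∷ []) R)) (map-ʳ++-unsplit ys zs (x ∷ rest) (□ ∷ []) split))
        (emitQuery-run zs x rest (□ ∷ []) h cnt (outputTapeAt k) zs0 x1 margin))
    ⨾ query-step cnt (emitted (x ∷ rest)) (outputTapeAt k) work (answerAt k) (trans (cong f asked) (oracle (mediantNum (pairAt k)) mediantDen∸1))
    ⨾ to≡ (cong (λ o → cellConfig (Replace (not (answerAt k))) cnt (tape [] (bit (answerAt k)) []) o work) (outputTape-next k))
        (answer-step (answerAt k) (reverse (map bit (hurwitz D k))) cnt work)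
    where
    written : Tape Cell
    written = atRight (reverse (map bit (emitted (x ∷ rest)))) []
    -- A FareyPair stores denominators minus one, so mediantDen (pairAt k) is suc mediantDen∸1 by definition.
    mediantDen∸1 : ℕ
    mediantDen∸1 = proj₁ (proj₂ (pairAt k)) + rightDen (pairAt k)
    work : Tape Cell
    work = atRight (□ ∷ []) (map col ys ++ □ ∷ [])

  replace-phase : ∀ β ys cnt q o →
    cellConfig (Replace β) cnt q o (atRight (□ ∷ []) (map col ys ++ □ ∷ [])) ↝⟨ length ys + (1 + (length ys + 1)) ∣ [] ⟩
    cellConfig Decrement cnt q o (atRight (□ ∷ []) (map col (map (replace β) ys ++ zeroColumn ∷ [])))
  replace-phase β ys cnt q o =
    replace-run β ys (□ ∷ []) (□ ∷ []) cnt q o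
    ⨾ replace-end β _ cnt q o
    ⨾ from≡ (cong (λ l → cellConfig Rewind cnt q o (atLeft l (col zeroColumn ∷ []))) rewound)
        (retime (cong (_+ 1) (trans (length-reverse us) (length-map (replace β) ys)))
          (rewind-run (reverse us) (□ ∷ []) (col zeroColumn ∷ []) cnt q o
           ⨾ to≡ (cong (λ r → cellConfig Decrement cnt q o (atRight (□ ∷ []) r)) appended) (rewind-end _ cnt q o)))
    where
    us : List Column
    us = map (replace β) ys
    rewound : map col us ʳ++ □ ∷ [] ≡ map col (reverse us) ++ □ ∷ []
    rewound = trans (ʳ++-defn (map col us)) (cong (_++ □ ∷ []) (sym (reverse-map col us)))
    appended : map col (reverse us) ʳ++ col zeroColumn ∷ [] ≡ map col (us ++ zeroColumn ∷ [])
    appended = begin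
      map col (reverse us) ʳ++ col zeroColumn ∷ []        ≡⟨ ʳ++-defn (map col (reverse us)) ⟩
      reverse (map col (reverse us)) ++ col zeroColumn ∷ [] ≡⟨ cong (_++ _) (reverse-map col (reverse us)) ⟨
      map col (reverse (reverse us)) ++ col zeroColumn ∷ [] ≡⟨ cong (λ l → map col l ++ _) (reverse-involutive us) ⟩
      map col us ++ map col (zeroColumn ∷ [])               ≡⟨ map-++ col us _ ⟨
      map col (us ++ zeroColumn ∷ [])                       ∎
      where open ≡-Reasoning

  record RoundOutcome (n j : ℕ) (rest : List Bool) (h : Cell) (k : ℕ) (xs : List Column) (l : List Cell) : Set where
    field
      columns′   : List Column
      time size  : ℕ
      run        : roundStart (replicate j false ++ true ∷ rest) h k xs l ↝⟨ time ∣ size ∷ [] ⟩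
                   roundStart (replicate j true ++ false ∷ rest) (bit (answerAt k)) (suc k) columns′ (□ ∷ [])
      represents : Represents (pairAt (suc k)) columns′ (suc (suc (suc k)))
      time≤      : time ≤ 13 * suc n
      size≤      : size ≤ 4 * n

  round : ∀ {n} k j rest h xs {l} → Represents (pairAt k) xs (suc (suc k)) → Margin l → suc k ≤ n → suc j ≤ n →
    RoundOutcome n j rest h k xs l
  round {n} k j rest h xs {l} repr margin k<n j<n = byTopDen (topDenColumn (reverse ys))
    where
    ys : List Column
    ys = withMediant xs
    β : Bool
    β = not (answerAt k)
    mediant : (track mNum ys ≡ mediantNum (pairAt k)) × (track mDen ys ≡ mediantDen (pairAt k))
    mediant = mediant-withMediant {xs = xs} repr (hurwitz-bounded D k)
    num≤den : track mNum ys ≤ track mDen ys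
    num≤den with _ , _ , ln≤ , rn≤ ← hurwitz-bounded D k =
      subst₂ _≤_ (sym (proj₁ mediant)) (sym (proj₂ mediant)) (+-mono-≤ ln≤ rn≤)
    w≤ : length xs ≤ suc n
    w≤ = subst (_≤ suc n) (sym (proj₂ (proj₂ (proj₂ (proj₂ repr))))) (s≤s k<n)
    byTopDen : All (λ z → mDen z ≡ false) (reverse ys) ⊎
      Σ (List Column) (λ zs → Σ Column λ x → Σ (List Column) λ rest′ →
        (reverse ys ≡ zs ++ x ∷ rest′) × All (λ z → mDen z ≡ false) zs × (mDen x ≡ true)) →
      RoundOutcome n j rest h k xs l
    byTopDen (inj₁ all0) = ⊥-elim (0≢1+n (trans (sym (fromBits-allFalse (map⁺ allDen0))) (proj₂ mediant)))
      where
      allDen0 : All (λ z → mDen z ≡ false) ys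
      allDen0 = subst (All (λ z → mDen z ≡ false)) (reverse-involutive ys) (All-reverse all0)
    byTopDen (inj₂ (zs , x , rest′ , split , zs0 , x1)) = record
      { columns′   = map (replace β) ys ++ zeroColumn ∷ []
      ; run        = decrement-phase j rest h k xs l
                     ⨾ add-run false false xs l cnt (tape [] h []) (outputTapeAt k)
                     ⨾ query-phase k ys zs x rest′ cnt h split zs0 x1 margin
                         (trans (emitted-encQ ys zs x rest′ split zs0 x1 num≤den) (cong₂ encQ (proj₁ mediant) (proj₂ mediant)))
                     ⨾ replace-phase β ys cnt (tape [] (bit (answerAt k)) []) (outputTapeAt (suc k))
      ; represents = subst (λ p → Represents p (map (replace β) ys ++ zeroColumn ∷ []) (suc (suc (suc k))))
                       (sym (farey-∷ʳ (hurwitz D k) β)) (represents-next {xs = xs} β repr (proj₁ mediant) (proj₂ mediant))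
      ; time≤      = round-time≤ j<n w≤ (length-addColumns false false xs) columnsSplit (length-emitted (x ∷ rest′))
      ; size≤      = query-size≤ k<n (subst (suc (length rest′) ≤_) columnsSplit (m≤n+m _ (length zs))) w≤ (length-emitted (x ∷ rest′))
      }
      where
      cnt : Tape Cell
      cnt = atLeft (map bit (replicate j true ++ false ∷ rest)) (□ ∷ [])
      columnsSplit : length zs + suc (length rest′) ≡ length xs
      columnsSplit = trans (sym (length-++ zs)) (trans (cong length (sym split)) (trans (length-reverse ys) (length-addColumns false false xs)))

  record Completion (n remaining : ℕ) (c₀ : CellConfig) : Set where
    field
      final    : CellConfig
      time     : ℕ
      sizes    : List ℕ
      run      : c₀ ↝⟨ time ∣ sizes ⟩ final
      halted   : state final ≡ Halt
      written  : outputTape final ≡ outputTapeAt n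
      time≤    : time ≤ suc remaining * (13 * suc n)
      #queries : length sizes ≡ remaining
      sizes≤   : All (_≤ 4 * n) sizes

  -- The counter bs holds the number r of rounds still to go; round k computes bit k + 1 of the characteristic.
  rounds : ∀ n r k bs h xs {l} → k + r ≡ n → fromBits bs ≡ r → length bs ≤ n → Represents (pairAt k) xs (suc (suc k)) → Margin l →
    Completion n r (roundStart bs h k xs l)
  rounds n zero k bs h xs {l} k+0≡n bs≡0 bs≤n repr margin = record
    { run      = from≡ (cong (λ b → roundStart b h k xs l) (fromBits≡0⇒replicate bs bs≡0))
                   (decrement-exhausted (length bs) (□ ∷ []) (tape [] h []) (outputTapeAt k) (atRight l (map col xs)))
    ; halted   = refl
    ; written  = cong outputTapeAt (trans (sym (+-identityʳ k)) k+0≡n)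
    ; time≤    = ≤-trans (s≤s bs≤n) (≤-trans (m≤n*m (suc n) 13) (≤-reflexive (sym (+-identityʳ (13 * suc n)))))
    ; #queries = refl
    ; sizes≤   = []
    }
  rounds n (suc r) k bs h xs {l} k+r≡n bs≡ bs≤n repr margin with fromBits≡suc⇒view bs bs≡
  ... | j , rest , refl = record
    { run      = RoundOutcome.run this ⨾ Completion.run later
    ; halted   = Completion.halted later
    ; written  = Completion.written later
    ; time≤    = +-mono-≤ (RoundOutcome.time≤ this) (Completion.time≤ later)
    ; #queries = cong suc (Completion.#queries later)
    ; sizes≤   = RoundOutcome.size≤ this ∷ Completion.sizes≤ later
    }
    where
    k<n : suc k ≤ n
    k<n = subst (suc k ≤_) k+r≡n (subst (_≤ k + suc r) (+-comm k 1) (+-monoʳ-≤ k (s≤s z≤n)))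
    j<n : suc j ≤ n
    j<n = ≤-trans (past-zeros j) bs≤n
      where
      past-zeros : ∀ j → suc j ≤ length (replicate j false ++ true ∷ rest)
      past-zeros zero    = s≤s z≤n
      past-zeros (suc j) = s≤s (past-zeros j)
    this : RoundOutcome n j rest h k xs l
    this = round k j rest h xs repr margin k<n j<n
    later : Completion n r (roundStart (replicate j true ++ false ∷ rest) (bit (answerAt k)) (suc k) (RoundOutcome.columns′ this) (□ ∷ []))
    later = rounds n r (suc k) (replicate j true ++ false ∷ rest) (bit (answerAt k)) (RoundOutcome.columns′ this)
              (trans (sym (+-suc k r)) k+r≡n)
              (suc-injective (trans (fromBits-decrement j rest) bs≡))
              (subst (_≤ n) (sym (length-decrement j rest)) bs≤n)
              (RoundOutcome.represents this) one

  blankTape : Tape Cell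
  blankTape = tape [] □ []

  initialise : ∀ n →
    cellConfig ScanInput (atRight [] (map bit (bin n))) blankTape blankTape blankTape ↝⟨ suc (length (bin n)) + 2 ∣ [] ⟩
    roundStart (binLSB n n) □ 0 (rootColumn ∷ zeroColumn ∷ []) []
  initialise n =
    to≡ (cong (λ bs → cellConfig PutFirstColumn (atLeft bs (□ ∷ [])) blankTape blankTape blankTape) counterBits)
      (scanInput-run (bin n) [] blankTape blankTape blankTape)
    ⨾ putColumns-run _ blankTape blankTape
    where
    counterBits : map bit (bin n) ʳ++ [] ≡ map bit (binLSB n n)
    counterBits = trans (sym (reverse-map bit (bin n))) (cong (map bit) (reverse-involutive (binLSB n n)))

  computesHurwitz : ∀ n → Σ (Config hurwitzMachine) λ c′ → Σ ℕ λ t → Σ (List ℕ) λ qs →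
    Runs f hurwitzMachine (initConfig f hurwitzMachine n) t qs c′ × output f hurwitzMachine c′ ≡ hurwitz D n ×
    t ≤ 16 * suc n ^ 2 × length qs ≡ n × All (λ s → s ≤ 4 * n) qs
  computesHurwitz n =
    encodeConfig final , suc (length (bin n)) + 2 + time , sizes ,
    subst (λ c → Runs f hurwitzMachine c (suc (length (bin n)) + 2 + time) sizes (encodeConfig final)) (sym start≡)
      (Exec⇒Runs (exec (initialise n ⨾ run)) (cong stateIndex halted)) ,
    trans (cong (λ T → wordOn (encodeTape T)) written) (wordOn-written (hurwitz D n)) ,
    total-time≤ (subst (_≤ n) (sym (length-reverse (binLSB n n))) (length-binLSB n n)) time≤ ,
    #queries , sizes≤
    where
    open Completion (rounds n n 0 (binLSB n n) □ (rootColumn ∷ zeroColumn ∷ []) refl (fromBits-binLSB n n ≤-refl) (length-binLSB n n) represents-root none)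
    start≡ : initConfig f hurwitzMachine n ≡ encodeConfig (cellConfig ScanInput (atRight [] (map bit (bin n))) blankTape blankTape blankTape)
    start≡ = cong (λ T → conf (stateIndex ScanInput) (T ∷ᵥ _)) (tapeOf-encode (bin n))

mainTheorem17 : (D : ℚ → Bool) → IrrationalCutIn01 D →
    Σ OTM λ M → Σ ℕ λ c → Σ ℕ λ k → Σ ℕ λ C →
      (f : Word → Word) → (∀ p q → f (encQ p (suc q)) ≡ D (+ p ÷ suc q) ∷ []) →
      Σ (ℕ → Word) λ H → IsHurwitzChar D H ×
        ((n : ℕ) → Σ (Config M) λ c' → Σ ℕ λ t → Σ (List ℕ) λ qs →
          Runs f M (initConfig f M n) t qs c' × output f M c' ≡ H n ×
          t ≤ c * suc n ^ k × length qs ≡ n × All (λ s → s ≤ C * n) qs)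
mainTheorem17 D cut =
  hurwitzMachine , 16 , 2 , 4 , λ f oracle → hurwitz D , hurwitz-isHurwitzChar D cut , Rounds.computesHurwitz D f oracle
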